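{- For all fixed positive integers $k$ and $\ell$, the generating function $\sum_{b\ge0}J(b,k,\ell)x^b$ is a rational function in $x$.
   Context: A composition is a finite sequence of positive integers; its size is the sum of its parts (the empty sequence is the composition of $0$). Write $[n]=\{1,\dots,n\}$. A (multiplex juggling) card is a triple $(\alpha,\beta,f)$ where $\alpha=(\alpha_1,\dots,\alpha_s)$ and $\beta=(\beta_1,\dots,\beta_t)$ are compositions with $|\alpha|=|\beta|$, and $f:[s]\to\{0\}\cup[t]$ is strictly increasing such that for all $i\in[s]$, if $f(i)\neq0$ then $\alpha_i\le\beta_{f(i)}$; $\alpha$ is the arrival and $\beta$ the departure composition. The card has $|\alpha|$ balls and has capacity $k$ if every part of $\alpha$ and $\beta$ is at most $k$. An $\ell$-card sequence with $b$ balls and capacity $k$ is a sequence $(C_1,\dots,C_\ell)$ of cards with $b$ balls and capacity $k$ such that the departure composition of $C_i$ equals the arrival composition of $C_{i+1}$ for all $i\in[\ell-1]$; $J(b,k,\ell)$ is the number of such sequences. -}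

module Defs where

open import Data.Nat using (ℕ; zero; suc; _≤_; _<_)
open import Data.List using (List; []; _∷_; length)
open import Data.Nat.ListAction using (sum)
open import Data.Integer using (+_)
open import Data.List.Relation.Unary.All using (All)
open import Data.List.Relation.Unary.Any using (Any)
open import Data.List.Relation.Unary.Linked using (Linked)
open import Data.List.Relation.Binary.Pointwise using (Pointwise)
open import Data.Product using (Σ; ∃; _×_)
open import Data.Unit using (⊤)
open import Data.Empty using (⊥)
open import Data.Fin using (Fin)
open import Function.Bundles using (_↔_)
open import Relation.Binary.PropositionalEquality using (_≡_; _≢_)
open import Data.Rational using (ℚ; 0ℚ; _+_; _*_)
import Data.Rational as ℚ

PartOK : ℕ → ℕ → Set
PartOK k x = (1 ≤ x) × (x ≤ k)

CompBK : ℕ → ℕ → List ℕ → Set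
CompBK b k γ = All (PartOK k) γ × (sum γ ≡ b)

-- AtMost β j a : β has a (0-based) j-th entry β_j and a ≤ β_j.
AtMost : List ℕ → ℕ → ℕ → Set
AtMost []       _       a = ⊥
AtMost (x ∷ xs) zero    a = a ≤ x
AtMost (x ∷ xs) (suc j) a = AtMost xs j a

-- Fits β a j : the value j ∈ {0} ∪ [t] (t = length β) assigned to an arrival
-- part a is legal: j = 0, or 1 ≤ j ≤ t and a ≤ β_j (1-based).
Fits : List ℕ → ℕ → ℕ → Set
Fits β a zero    = ⊤
Fits β a (suc j) = AtMost β j a

-- A card with b balls and capacity k: (α , β , f) where f : [s] → {0} ∪ [t]
-- is given by the list of its values (f(1), …, f(s)); it is strictly
-- increasing and satisfies f(i) ≠ 0 → α_i ≤ β_{f(i)} (Pointwise forces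
-- length f = s, Fits forces values in {0,…,t}).
record Card (b k : ℕ) : Set where
  constructor card
  field
    arr    : List ℕ
    dep    : List ℕ
    arrOK  : CompBK b k arr
    depOK  : CompBK b k dep
    f      : List ℕ
    f-inc  : Linked _<_ f
    f-fits : Pointwise (Fits dep) arr f

Chains : ∀ {b k} → Card b k → Card b k → Set
Chains C D = Card.dep C ≡ Card.arr D

CardSeq : ℕ → ℕ → ℕ → Set
CardSeq b k ℓ = Σ (List (Card b k)) λ cs → (length cs ≡ ℓ) × Linked Chains cs

coeff : List ℚ → ℕ → ℚ
coeff []       _       = 0ℚ
coeff (c ∷ cs) zero    = c
coeff (c ∷ cs) (suc n) = coeff cs n

-- mulCoeff q a n : n-th coefficient of Q(x) · Σ a_m x^m, where Q has
-- coefficient list q.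
mulCoeff : List ℚ → (ℕ → ℚ) → ℕ → ℚ
mulCoeff []       a n       = 0ℚ
mulCoeff (c ∷ cs) a zero    = c * a zero
mulCoeff (c ∷ cs) a (suc n) = c * a (suc n) + mulCoeff cs a n

-- The generating function Σ_b a_b x^b is a rational function: there are
-- polynomials P, Q (over ℚ) with Q ≠ 0 and Q · F = P as formal power series.
IsRationalGF : (ℕ → ℕ) → Set
IsRationalGF a =
  ∃ λ (P : List ℚ) → ∃ λ (Q : List ℚ) →
    Any (λ c → c ≢ 0ℚ) Q ×
    (∀ n → mulCoeff Q (λ m → (+ a m) ℚ./ 1) n ≡ coeff P n)

{-# OPTIONS --safe #-}

-- Write the ℓ + 1 compositions of a card sequence as the rows of a stack.  The map f of a card
-- links consecutive rows: either it matches every arrival part, order-preservingly, with a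
-- departure part at least as large (matched), or it sends the first arrival part to 0 and
-- matches the others (pending).  Give every row a deficit, the amount by which its sum falls
-- short of n, the sum of the last row.  Removing the first column of a stack leaves a stack
-- whose links, deficits and n are determined by the column, so the number of stacks satisfies
-- a recursion over columns.  A column either resolves a pending link, or, once all links are
-- matched, it is plain (it removes one part t from every row and keeps the deficits) or it
-- lowers the total deficit.  Hence, with L = 1 − Σ x^t over the plain columns, L times the
-- generating series of the all-matched stacks with deficits ds is a polynomial plus series of
-- smaller total deficit, and induction shows that every such series is P / L^j.
module Submission where

open import Defs
open import Data.Nat using (ℕ; zero; suc; pred; _+_; _∸_; _^_; _≤_; _<_; z≤n; s≤s; s<s; s≤s⁻¹; s<s⁻¹; _≤?_; _<?_; _≟_; _⊔_)
import Data.Nat.Properties as ℕ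
open import Data.Nat.ListAction using (sum)
open import Data.Fin using (Fin; zero; suc; toℕ; fromℕ<)
open import Data.Fin.Properties using (+↔⊎; *↔×; 1↔⊤; toℕ<n; fromℕ<-toℕ; toℕ-fromℕ<)
open import Data.Fin.Permutation using (↔⇒≡)
open import Data.Integer as ℤ using (+_)
import Data.Integer.Properties as ℤ
import Data.Nat.Coprimality as Coprime
open import Data.Rational as ℚ using (ℚ; 0ℚ; 1ℚ; mkℚ)
import Data.Rational.Properties as ℚ
open import Data.Rational.Solver using (module +-*-Solver)
open +-*-Solver using (solve; _:+_; _:*_; :-_; con; _:=_)
open import Algebra.Bundles using (CommutativeRing)
open import Algebra.Properties.Semiring.Sum ℕ.+-*-semiring using (sum-syntax)
import Algebra.Properties.Semiring.Sum (CommutativeRing.semiring ℚ.+-*-commutativeRing) as ℚΣ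
open import Data.Bool using (if_then_else_)
open import Data.Bool.Properties using (if-float)
open import Data.Empty using (⊥; ⊥-elim; ⊥-elim-irr)
open import Data.Unit using (⊤; tt)
open import Data.Irrelevant using ([_]) renaming (Irrelevant to Squash)
open import Data.Maybe using (Maybe; just; nothing; fromMaybe)
open import Data.Maybe.Properties using (just-injective)
open import Data.List using (List; []; _∷_; map; length)
open import Data.List.Properties using (map-∘; map-id)
open import Data.List.Relation.Unary.All as All using (All; []; _∷_; all?)
open import Data.List.Relation.Unary.Any using (Any; here)
open import Data.List.Relation.Unary.Linked as Linked using (Linked; []; [-]; _∷_)
import Data.List.Relation.Unary.Linked.Properties as Linked
open import Data.List.Relation.Binary.Pointwise using (Pointwise; []; _∷_)
import Data.List.Relation.Binary.Pointwise.Properties as Pointwise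
open import Data.Vec as Vec using (Vec; []; _∷_; replicate)
open import Data.Vec.Properties using (∷-injectiveˡ; ∷-injectiveʳ) renaming (≡-dec to Vec-≡-dec)
open import Data.Product using (Σ; ∃; _×_; _,_; proj₁; proj₂)
open import Data.Product.Properties using (∃∃↔∃∃)
open import Data.Product.Function.Dependent.Propositional using (Σ-↔)
open import Data.Product.Function.NonDependent.Propositional using (_×-↔_)
open import Data.Sum as Sum using (_⊎_; inj₁; inj₂)
open import Data.Sum.Function.Propositional using (_⊎-↔_)
open import Function using (_∘_)
open import Function.Bundles using (_↔_; Inverse; mk↔ₛ′)
open import Function.Properties.Inverse using (↔-refl; ↔-sym; ↔-trans)
open import Function.Related.TypeIsomorphisms using (×-distribˡ-⊎; Σ-distribˡ-⊎)
open import Relation.Nullary using (¬_; Dec; yes; no; does; Irrelevant)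
open import Relation.Nullary.Decidable using (recompute; _×-dec_; dec-true)
open import Relation.Binary.PropositionalEquality
  using (_≡_; _≢_; _≗_; refl; sym; trans; cong; cong₂; subst; module ≡-Reasoning)

-- Finite enumerations

infixr 4 _⨾_
_⨾_ : ∀ {A B C : Set} → A ↔ B → B ↔ C → A ↔ C
_⨾_ = ↔-trans

Fin-cong : ∀ {m n} → m ≡ n → Fin m ↔ Fin n
Fin-cong refl = ↔-refl

↔Fin-unique : ∀ {A : Set} {m n} → A ↔ Fin m → A ↔ Fin n → m ≡ n
↔Fin-unique e f = ↔⇒≡ (↔-sym e ⨾ f)

Σ-Fin-suc : ∀ {n} {P : Fin (suc n) → Set} → Σ (Fin (suc n)) P ↔ (P zero ⊎ Σ (Fin n) (P ∘ suc))
Σ-Fin-suc = mk↔ₛ′ (λ { (zero , p) → inj₁ p ; (suc i , p) → inj₂ (i , p) })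
                  (λ { (inj₁ p) → zero , p ; (inj₂ (i , p)) → suc i , p })
                  (λ { (inj₁ _) → refl ; (inj₂ _) → refl })
                  (λ { (zero , _) → refl ; (suc _ , _) → refl })

Σ-Fin↔Fin-∑ : ∀ n (g : Fin n → ℕ) → Σ (Fin n) (Fin ∘ g) ↔ Fin (∑[ i < n ] g i)
Σ-Fin↔Fin-∑ zero    g = mk↔ₛ′ (λ { (() , _) }) (λ ()) (λ ()) (λ { (() , _) })
Σ-Fin↔Fin-∑ (suc n) g = Σ-Fin-suc ⨾ (↔-refl ⊎-↔ Σ-Fin↔Fin-∑ n (g ∘ suc)) ⨾ ↔-sym +↔⊎

Σ↔Fin-∑ : ∀ {A : Set} {B : A → Set} {n} (e : A ↔ Fin n) (g : A → ℕ) →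
          (∀ a → B a ↔ Fin (g a)) → Σ A B ↔ Fin (∑[ i < n ] g (Inverse.from e i))
Σ↔Fin-∑ {n = n} e g B↔ =
  Σ-↔ e (λ {a} → B↔ a ⨾ Fin-cong (cong g (sym (Inverse.strictlyInverseʳ e a))))
  ⨾ Σ-Fin↔Fin-∑ n (g ∘ Inverse.from e)

Squash×↔Fin : ∀ {P B : Set} {m} (P? : Dec P) → (P → B ↔ Fin m) →
              (Squash P × B) ↔ Fin (if does P? then m else 0)
Squash×↔Fin (yes p) B↔ = mk↔ₛ′ proj₂ ([ p ] ,_) (λ _ → refl) (λ _ → refl) ⨾ B↔ p
Squash×↔Fin (no ¬p) _  = mk↔ₛ′ (λ { ([ p ] , _) → ⊥-elim-irr (¬p p) }) (λ ())
                               (λ ()) (λ { ([ p ] , _) → ⊥-elim-irr (¬p p) })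

Squash↔Fin : ∀ {P : Set} (P? : Dec P) → Squash P ↔ Fin (if does P? then 1 else 0)
Squash↔Fin P? = mk↔ₛ′ (_, tt) proj₁ (λ _ → refl) (λ _ → refl) ⨾ Squash×↔Fin P? (λ _ → ↔-sym 1↔⊤)

if-×-dec : ∀ {P Q : Set} (P? : Dec P) (Q? : Dec Q) m →
           (if does (P? ×-dec Q?) then m else 0) ≡ (if does Q? then (if does P? then m else 0) else 0)
if-×-dec (yes _) (yes _) m = refl
if-×-dec (yes _) (no _)  m = refl
if-×-dec (no _)  (yes _) m = refl
if-×-dec (no _)  (no _)  m = refl

Σ-Squash-≡ : ∀ {A : Set} {P : A → Set} {a b} {p : Squash (P a)} {q : Squash (P b)} → a ≡ b → (a , p) ≡ (b , q)
Σ-Squash-≡ refl = refl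

Interval↔Fin : ∀ w → (Σ ℕ λ a → Squash (1 ≤ a × a ≤ w)) ↔ Fin w
Interval↔Fin w = mk↔ₛ′ to from (λ i → fromℕ<-toℕ i _) from∘to
  where
  to : (Σ ℕ λ a → Squash (1 ≤ a × a ≤ w)) → Fin w
  to (zero  , [ p ]) = ⊥-elim-irr (ℕ.n≮0 (proj₁ p))
  to (suc a , [ p ]) = fromℕ< (proj₂ p)
  from : Fin w → Σ ℕ λ a → Squash (1 ≤ a × a ≤ w)
  from i = suc (toℕ i) , [ s≤s z≤n , toℕ<n i ]
  from∘to : ∀ x → from (to x) ≡ x
  from∘to (zero  , [ p ]) = ⊥-elim-irr (ℕ.n≮0 (proj₁ p))
  from∘to (suc a , [ p ]) = Σ-Squash-≡ (cong suc (toℕ-fromℕ< _))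

-- Labellings of arrival parts and matchings

Linked-<-irrelevant : ∀ {g} → Irrelevant (Linked _<_ g)
Linked-<-irrelevant []       []       = refl
Linked-<-irrelevant [-]      [-]      = refl
Linked-<-irrelevant (p ∷ ps) (q ∷ qs) = cong₂ _∷_ (ℕ.<-irrelevant p q) (Linked-<-irrelevant ps qs)

Labelling : (ℕ → ℕ → Set) → List ℕ → Set
Labelling H γ = Σ (List ℕ) λ g → Linked _<_ g × Pointwise H γ g

ShiftIndex : (ℕ → ℕ → Set) → ℕ → ℕ → Set
ShiftIndex H a j = H a (suc j)

HeadAtZero : (ℕ → ℕ → Set) → List ℕ → Set
HeadAtZero H []      = ⊥
HeadAtZero H (a ∷ γ) = H a 0 × Labelling (ShiftIndex H) γ

map-suc-pred : ∀ {x g} → Linked _<_ (x ∷ g) → map suc (map pred g) ≡ g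
map-suc-pred {g = []}        _        = refl
map-suc-pred {g = suc y ∷ g} (_ ∷ lk) = cong (suc y ∷_) (map-suc-pred lk)

map-pred-suc : ∀ g → map pred (map suc g) ≡ g
map-pred-suc g = trans (sym (map-∘ g)) (map-id g)

Linked-map-suc : ∀ {g} → Linked _<_ g → Linked _<_ (map suc g)
Linked-map-suc = Linked.map⁺ ∘ Linked.map s<s

Linked-map-suc⁻ : ∀ {g} → Linked _<_ (map suc g) → Linked _<_ g
Linked-map-suc⁻ = Linked.map s<s⁻¹ ∘ Linked.map⁻

Linked-zero∷map-suc : ∀ {g} → Linked _<_ g → Linked _<_ (zero ∷ map suc g)
Linked-zero∷map-suc {[]}    _  = [-]
Linked-zero∷map-suc {_ ∷ _} lk = s≤s z≤n ∷ Linked-map-suc lk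

Labelling-≡ : ∀ {H γ g g′} {p : Linked _<_ g × Pointwise H γ g} {p′ : Linked _<_ g′ × Pointwise H γ g′} →
              (∀ {a j} → Irrelevant (H a j)) → g ≡ g′ → _≡_ {A = Labelling H γ} (g , p) (g′ , p′)
Labelling-≡ {p = l , w} {l′ , w′} H-irrelevant refl =
  cong (_ ,_) (cong₂ _,_ (Linked-<-irrelevant l l′) (Pointwise.irrelevant H-irrelevant w w′))

module _ {H : ℕ → ℕ → Set} where

  Pointwise-map-suc : ∀ {γ g} → Pointwise (ShiftIndex H) γ g → Pointwise H γ (map suc g)
  Pointwise-map-suc []       = []
  Pointwise-map-suc (h ∷ pw) = h ∷ Pointwise-map-suc pw

  Pointwise-map-suc⁻ : ∀ {γ g} → Pointwise H γ (map suc g) → Pointwise (ShiftIndex H) γ g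
  Pointwise-map-suc⁻ {g = []}    []       = []
  Pointwise-map-suc⁻ {g = _ ∷ _} (h ∷ pw) = h ∷ Pointwise-map-suc⁻ pw

  unshift : ∀ {x γ g} → Linked _<_ (x ∷ g) → Pointwise H γ g → Labelling (ShiftIndex H) γ
  unshift {γ = γ} {g} lk pw = map pred g ,
    Linked-map-suc⁻ (subst (Linked _<_) (sym (map-suc-pred lk)) (Linked.tail lk)) ,
    Pointwise-map-suc⁻ (subst (Pointwise H γ) (sym (map-suc-pred lk)) pw)

  Labelling-split : (∀ {a j} → Irrelevant (H a j)) →
                    ∀ γ → Labelling H γ ↔ (Labelling (ShiftIndex H) γ ⊎ HeadAtZero H γ)
  Labelling-split H-irrelevant γ = mk↔ₛ′ split join split∘join join∘split
    where
    split : ∀ {γ} → Labelling H γ → Labelling (ShiftIndex H) γ ⊎ HeadAtZero H γ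
    split ([] , _ , [])            = inj₁ ([] , [] , [])
    split (zero ∷ g , lk , h ∷ pw) = inj₂ (h , unshift lk pw)
    split (suc j ∷ g , lk , pw)    = inj₁ (unshift (s≤s z≤n ∷ lk) pw)

    join : ∀ {γ} → Labelling (ShiftIndex H) γ ⊎ HeadAtZero H γ → Labelling H γ
    join (inj₁ (g , lk , pw))              = map suc g , Linked-map-suc lk , Pointwise-map-suc pw
    join {_ ∷ _} (inj₂ (h , g , lk , pw)) = zero ∷ map suc g , Linked-zero∷map-suc lk , h ∷ Pointwise-map-suc pw

    split∘join : ∀ {γ} x → split {γ} (join x) ≡ x
    split∘join (inj₁ ([] , [] , []))         = refl
    split∘join (inj₁ (j ∷ g , _ , _))        = cong inj₁ (Labelling-≡ H-irrelevant (map-pred-suc (j ∷ g)))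
    split∘join {_ ∷ _} (inj₂ (h , g , _ , _)) = cong (inj₂ ∘ (h ,_)) (Labelling-≡ H-irrelevant (map-pred-suc g))

    join∘split : ∀ {γ} x → join {γ} (split x) ≡ x
    join∘split ([] , [] , [])          = refl
    join∘split (zero ∷ g , lk , _ ∷ _) = Labelling-≡ H-irrelevant (cong (zero ∷_) (map-suc-pred lk))
    join∘split (suc j ∷ g , lk , _)    = Labelling-≡ H-irrelevant (map-suc-pred (s≤s z≤n ∷ lk))

data Matching : List ℕ → List ℕ → Set where
  []    : Matching [] []
  skip  : ∀ {α β y} → Matching α β → Matching α (y ∷ β)
  match : ∀ {α β a y} → a ≤ y → Matching α β → Matching (a ∷ α) (y ∷ β)

-- pending: f(1) = 0, so the first arrival part is unmatched.
data Mode : Set where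
  pending matched : Mode

Link : Mode → List ℕ → List ℕ → Set
Link matched α       β = Matching α β
Link pending []      β = ⊥
Link pending (_ ∷ α) β = Matching α β

Σ-Mode↔ : ∀ {P : Mode → Set} → Σ Mode P ↔ (P matched ⊎ P pending)
Σ-Mode↔ = mk↔ₛ′ (λ { (matched , p) → inj₁ p ; (pending , p) → inj₂ p })
                (λ { (inj₁ p) → matched , p ; (inj₂ p) → pending , p })
                (λ { (inj₁ _) → refl ; (inj₂ _) → refl })
                (λ { (matched , _) → refl ; (pending , _) → refl })

Mode↔Fin : Mode ↔ Fin 2
Mode↔Fin = mk↔ₛ′ (λ { pending → zero ; matched → suc zero }) (λ { zero → pending ; (suc zero) → matched })
                 (λ { zero → refl ; (suc zero) → refl }) (λ { pending → refl ; matched → refl })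

Modes↔Fin : ∀ ℓ → Vec Mode ℓ ↔ Fin (2 ^ ℓ)
Modes↔Fin zero    = mk↔ₛ′ (λ _ → zero) (λ _ → []) (λ { zero → refl }) (λ { [] → refl })
Modes↔Fin (suc ℓ) =
  mk↔ₛ′ {A = Vec Mode (suc ℓ)} (λ { (m ∷ ms) → m , ms }) (λ (m , ms) → m ∷ ms) (λ _ → refl) (λ { (_ ∷ _) → refl })
  ⨾ (Mode↔Fin ×-↔ Modes↔Fin ℓ) ⨾ ↔-sym *↔×

pendings : ∀ {ℓ} → Vec Mode ℓ → ℕ
pendings []             = 0
pendings (pending ∷ ms) = suc (pendings ms)
pendings (matched ∷ ms) = pendings ms

Exhausted : ∀ {ℓ} → Vec Mode ℓ → Vec ℕ ℓ → ℕ → Set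
Exhausted {ℓ} ms ds n = n ≡ 0 × ds ≡ replicate ℓ 0 × pendings ms ≡ 0

Exhausted? : ∀ {ℓ} (ms : Vec Mode ℓ) ds n → Dec (Exhausted ms ds n)
Exhausted? {ℓ} ms ds n = (n ≟ 0) ×-dec Vec-≡-dec _≟_ ds (replicate ℓ 0) ×-dec (pendings ms ≟ 0)

pendings≡0⇒allMatched : ∀ {ℓ} (ms : Vec Mode ℓ) → pendings ms ≡ 0 → ms ≡ replicate ℓ matched
pendings≡0⇒allMatched []             _  = refl
pendings≡0⇒allMatched (matched ∷ ms) p0 = cong (matched ∷_) (pendings≡0⇒allMatched ms p0)

pendings-allMatched : ∀ ℓ → pendings (replicate ℓ matched) ≡ 0
pendings-allMatched zero    = refl
pendings-allMatched (suc ℓ) = pendings-allMatched ℓ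

Below : List ℕ → ℕ → ℕ → Set
Below β a j = AtMost β j a

Below-irrelevant : ∀ β {a j} → Irrelevant (Below β a j)
Below-irrelevant (y ∷ β) {j = zero}  = ℕ.≤-irrelevant
Below-irrelevant (y ∷ β) {j = suc j} = Below-irrelevant β

Fits-irrelevant : ∀ β {a j} → Irrelevant (Fits β a j)
Fits-irrelevant β {j = zero}  _ _ = refl
Fits-irrelevant β {j = suc j}     = Below-irrelevant β

MatchedHead : ℕ → List ℕ → List ℕ → Set
MatchedHead y β []      = ⊥
MatchedHead y β (a ∷ α) = a ≤ y × Matching α β

Matching-∷ʳ : ∀ {y β} α → (Matching α β ⊎ MatchedHead y β α) ↔ Matching α (y ∷ β)
Matching-∷ʳ {y} {β} α = mk↔ₛ′ to from to∘from from∘to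
  where
  to : ∀ {α} → Matching α β ⊎ MatchedHead y β α → Matching α (y ∷ β)
  to (inj₁ m)                = skip m
  to {_ ∷ _} (inj₂ (le , m)) = match le m
  from : ∀ {α} → Matching α (y ∷ β) → Matching α β ⊎ MatchedHead y β α
  from (skip m)     = inj₁ m
  from (match le m) = inj₂ (le , m)
  to∘from : ∀ {α} (m : Matching α (y ∷ β)) → to (from m) ≡ m
  to∘from (skip _)    = refl
  to∘from (match _ _) = refl
  from∘to : ∀ {α} x → from {α} (to x) ≡ x
  from∘to (inj₁ _)         = refl
  from∘to {_ ∷ _} (inj₂ _) = refl

Labelling-Below↔Matching : ∀ β α → Labelling (Below β) α ↔ Matching α β
Labelling-Below↔Matching [] α =
  mk↔ₛ′ (λ { ([] , _ , []) → [] ; (_ , _ , () ∷ _) }) (λ { [] → [] , [] , [] })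
        (λ { [] → refl }) (λ { ([] , [] , []) → refl ; (_ , _ , () ∷ _) })
Labelling-Below↔Matching (y ∷ β) α =
  Labelling-split (λ {a} {j} → Below-irrelevant (y ∷ β) {a} {j}) α
  ⨾ (Labelling-Below↔Matching β α ⊎-↔ head α)
  ⨾ Matching-∷ʳ α
  where
  head : ∀ α → HeadAtZero (Below (y ∷ β)) α ↔ MatchedHead y β α
  head []      = ↔-refl
  head (a ∷ α) = ↔-refl ×-↔ Labelling-Below↔Matching β α

Labelling-Fits↔Link : ∀ β α → Labelling (Fits β) α ↔ Σ Mode (λ m → Link m α β)
Labelling-Fits↔Link β α =
  Labelling-split (λ {a} {j} → Fits-irrelevant β {a} {j}) α
  ⨾ (Labelling-Below↔Matching β α ⊎-↔ head α)
  ⨾ ↔-sym Σ-Mode↔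
  where
  head : ∀ α → HeadAtZero (Fits β) α ↔ Link pending α β
  head []      = ↔-refl
  head (a ∷ α) = mk↔ₛ′ proj₂ (tt ,_) (λ _ → refl) (λ _ → refl) ⨾ Labelling-Below↔Matching β α

Matching-sum-≤ : ∀ {γ β} → Matching γ β → sum γ ≤ sum β
Matching-sum-≤ []                   = z≤n
Matching-sum-≤ {β = y ∷ _} (skip m) = ℕ.≤-trans (Matching-sum-≤ m) (ℕ.m≤n+m _ y)
Matching-sum-≤ (match le m)         = ℕ.+-mono-≤ le (Matching-sum-≤ m)

+-exchange : ∀ v s d → v + s + d ≡ s + (v + d)
+-exchange v s d = trans (cong (_+ d) (ℕ.+-comm v s)) (ℕ.+-assoc s v d)

row-shrink : ∀ {v s d n t} → s ≤ n ∸ t → t ≤ n → v + s + d ≡ n → t ≤ v + d × s + (v + d ∸ t) ≡ n ∸ t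
row-shrink {v} {s} {d} {n} {t} s≤n∸t t≤n e = t≤v+d , trans (sym (ℕ.+-∸-assoc s t≤v+d)) (cong (_∸ t) n≡)
  where
  n≡ : s + (v + d) ≡ n
  n≡ = trans (sym (+-exchange v s d)) e
  t≤v+d : t ≤ v + d
  t≤v+d = ℕ.+-cancelˡ-≤ s t (v + d)
            (subst (s + t ≤_) (trans (ℕ.m∸n+n≡m t≤n) (sym n≡)) (ℕ.+-monoˡ-≤ t s≤n∸t))

row-grow : ∀ {v s d n t} → t ≤ n → t ≤ v + d → s + (v + d ∸ t) ≡ n ∸ t → v + s + d ≡ n
row-grow {v} {s} {d} {n} {t} t≤n t≤v+d e = begin
  v + s + d             ≡⟨ +-exchange v s d ⟩
  s + (v + d)           ≡⟨ ℕ.m∸n+n≡m (ℕ.≤-trans t≤v+d (ℕ.m≤n+m (v + d) s)) ⟨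
  s + (v + d) ∸ t + t   ≡⟨ cong (_+ t) (trans (ℕ.+-∸-assoc s t≤v+d) e) ⟩
  n ∸ t + t             ≡⟨ ℕ.m∸n+n≡m t≤n ⟩
  n                     ∎
  where open ≡-Reasoning


+≡⇒≡∸ : ∀ {m x n} → m + x ≡ n → m ≤ n × x ≡ n ∸ m
+≡⇒≡∸ {m} {x} refl = ℕ.m≤m+n m x , sym (ℕ.m+n∸m≡n m x)

≡∸⇒+≡ : ∀ {m x n} → m ≤ n → x ≡ n ∸ m → m + x ≡ n
≡∸⇒+≡ m≤n refl = ℕ.m+[n∸m]≡n m≤n

+∸-≤ : ∀ {a d t} → a ≤ t → a + d ∸ t ≤ d
+∸-≤ {a} {d} {t} a≤t = subst (a + d ∸ t ≤_) (ℕ.m+n∸m≡n a d) (ℕ.∸-monoʳ-≤ (a + d) a≤t)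

+∸-< : ∀ {a d t} → a < t → t ≤ a + d → a + d ∸ t < d
+∸-< {a} {d} {t} a<t t≤a+d = subst (a + d ∸ t <_) (ℕ.m+n∸m≡n a d) (ℕ.∸-monoʳ-< a<t t≤a+d)

-- Formal power series

Series : Set
Series = ℕ → ℚ

Polynomial : Set
Polynomial = List ℚ

toℚ : ℕ → ℚ
toℚ m = + m ℚ./ 1

toℚ-+ : ∀ m n → toℚ (m + n) ≡ toℚ m ℚ.+ toℚ n
toℚ-+ m n = sym (begin
  toℚ m ℚ.+ toℚ n                                 ≡⟨ cong₂ ℚ._+_ (as-mkℚ m) (as-mkℚ n) ⟩
  (+ m ℤ.* + 1 ℤ.+ + n ℤ.* + 1) ℚ./ 1             ≡⟨ cong (ℚ._/ 1) (cong₂ ℤ._+_ (ℤ.*-identityʳ (+ m)) (ℤ.*-identityʳ (+ n))) ⟩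
  toℚ (m + n)                                     ∎)
  where
  open ≡-Reasoning
  as-mkℚ : ∀ m → toℚ m ≡ mkℚ (+ m) 0 (Coprime.sym (Coprime.1-coprimeTo m))
  as-mkℚ m = ℚ.normalize-coprime (Coprime.sym (Coprime.1-coprimeTo m))

toℚ-∑ : ∀ N (g : Fin N → ℕ) → toℚ (∑[ i < N ] g i) ≡ ℚΣ.sum (toℚ ∘ g)
toℚ-∑ zero    g = refl
toℚ-∑ (suc N) g = trans (toℚ-+ (g zero) _) (cong (toℚ (g zero) ℚ.+_) (toℚ-∑ N (g ∘ suc)))

shift : ℕ → Series → Series
shift zero    a n       = a n
shift (suc t) a zero    = 0ℚ
shift (suc t) a (suc n) = shift t a n

shift-≤ : ∀ {t n} (a : Series) → t ≤ n → shift t a n ≡ a (n ∸ t)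
shift-≤ {zero}          a _       = refl
shift-≤ {suc t} {suc n} a (s≤s p) = shift-≤ a p

shift-≰ : ∀ {t n} (a : Series) → ¬ t ≤ n → shift t a n ≡ 0ℚ
shift-≰ {zero}          a t≰n = ⊥-elim (t≰n z≤n)
shift-≰ {suc t} {zero}  a _   = refl
shift-≰ {suc t} {suc n} a t≰n = shift-≰ a (t≰n ∘ s≤s)

toℚ-if-≤ : ∀ {t n} (t≤?n : Dec (t ≤ n)) (f : ℕ → ℕ) → toℚ (if does t≤?n then f (n ∸ t) else 0) ≡ shift t (toℚ ∘ f) n
toℚ-if-≤ (yes t≤n) f = sym (shift-≤ (toℚ ∘ f) t≤n)
toℚ-if-≤ (no  t≰n) f = sym (shift-≰ (toℚ ∘ f) t≰n)

EventuallyZero : Series → Set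
EventuallyZero a = ∃ λ M → ∀ n → M ≤ n → a n ≡ 0ℚ

mulCoeff-cong : ∀ p {a b : Series} → a ≗ b → mulCoeff p a ≗ mulCoeff p b
mulCoeff-cong []      a≗b n       = refl
mulCoeff-cong (c ∷ p) a≗b zero    = cong (c ℚ.*_) (a≗b 0)
mulCoeff-cong (c ∷ p) a≗b (suc n) = cong₂ ℚ._+_ (cong (c ℚ.*_) (a≗b (suc n))) (mulCoeff-cong p a≗b n)

mulCoeff-+ : ∀ p (a b : Series) n → mulCoeff p (λ m → a m ℚ.+ b m) n ≡ mulCoeff p a n ℚ.+ mulCoeff p b n
mulCoeff-+ []      a b n       = sym (ℚ.+-identityˡ 0ℚ)
mulCoeff-+ (c ∷ p) a b zero    = ℚ.*-distribˡ-+ c (a 0) (b 0)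
mulCoeff-+ (c ∷ p) a b (suc n) rewrite mulCoeff-+ p a b n =
  solve 5 (λ c x y u v → c :* (x :+ y) :+ (u :+ v) := (c :* x :+ u) :+ (c :* y :+ v))
          refl c (a (suc n)) (b (suc n)) (mulCoeff p a n) (mulCoeff p b n)

shift-suc : ∀ t (a : Series) → shift (suc t) a ≗ shift 1 (shift t a)
shift-suc t a zero    = refl
shift-suc t a (suc n) = refl

mulCoeff-shift1 : ∀ p (a : Series) → mulCoeff p (shift 1 a) ≗ shift 1 (mulCoeff p a)
mulCoeff-shift1 []      a zero          = refl
mulCoeff-shift1 []      a (suc n)       = refl
mulCoeff-shift1 (c ∷ p) a zero          = ℚ.*-zeroʳ c
mulCoeff-shift1 (c ∷ p) a (suc zero)    rewrite mulCoeff-shift1 p a zero = ℚ.+-identityʳ (c ℚ.* a 0)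
mulCoeff-shift1 (c ∷ p) a (suc (suc n)) rewrite mulCoeff-shift1 p a (suc n) = refl

mulCoeff-shift : ∀ p t (a : Series) → mulCoeff p (shift t a) ≗ shift t (mulCoeff p a)
mulCoeff-shift p zero    a n = refl
mulCoeff-shift p (suc t) a n = begin
  mulCoeff p (shift (suc t) a) n        ≡⟨ mulCoeff-cong p (shift-suc t a) n ⟩
  mulCoeff p (shift 1 (shift t a)) n    ≡⟨ mulCoeff-shift1 p (shift t a) n ⟩
  shift 1 (mulCoeff p (shift t a)) n    ≡⟨ shift1-cong (mulCoeff-shift p t a) n ⟩
  shift 1 (shift t (mulCoeff p a)) n    ≡⟨ shift-suc t (mulCoeff p a) n ⟨
  shift (suc t) (mulCoeff p a) n        ∎
  where
  open ≡-Reasoning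
  shift1-cong : ∀ {a b : Series} → a ≗ b → shift 1 a ≗ shift 1 b
  shift1-cong a≗b zero    = refl
  shift1-cong a≗b (suc n) = a≗b n

mulCoeff-EventuallyZero : ∀ p {a} → EventuallyZero a → EventuallyZero (mulCoeff p a)
mulCoeff-EventuallyZero p {a} (M , a≡0) = M + length p , vanish p
  where
  vanish : ∀ p n → M + length p ≤ n → mulCoeff p a n ≡ 0ℚ
  vanish []      n       _  = refl
  vanish (c ∷ p) zero    le = ⊥-elim (ℕ.n≮0 (subst (_≤ 0) (ℕ.+-suc M (length p)) le))
  vanish (c ∷ p) (suc n) le =
    trans (cong₂ ℚ._+_ (trans (cong (c ℚ.*_) (a≡0 (suc n) (ℕ.m+n≤o⇒m≤o M le))) (ℚ.*-zeroʳ c))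
                       (vanish p n (s≤s⁻¹ (subst (_≤ suc n) (ℕ.+-suc M (length p)) le))))
          (ℚ.+-identityʳ 0ℚ)

infixl 6 _+ₚ_
_+ₚ_ : Polynomial → Polynomial → Polynomial
[]      +ₚ q       = q
(a ∷ p) +ₚ []      = a ∷ p
(a ∷ p) +ₚ (b ∷ q) = a ℚ.+ b ∷ p +ₚ q

infixr 7 _·ₚ_
_·ₚ_ : ℚ → Polynomial → Polynomial
c ·ₚ p = map (c ℚ.*_) p

infixl 7 _*ₚ_
_*ₚ_ : Polynomial → Polynomial → Polynomial
[]      *ₚ q = []
(a ∷ p) *ₚ q = a ·ₚ q +ₚ (0ℚ ∷ p *ₚ q)

monomial : ℕ → ℚ → Polynomial
monomial zero    c = c ∷ []
monomial (suc t) c = 0ℚ ∷ monomial t c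

∑ₚ : ∀ N → (Fin N → Polynomial) → Polynomial
∑ₚ zero    f = []
∑ₚ (suc N) f = f zero +ₚ ∑ₚ N (f ∘ suc)

constantTerm : Polynomial → ℚ
constantTerm []      = 0ℚ
constantTerm (c ∷ _) = c

mulCoeff-+ₚ : ∀ p q (a : Series) n → mulCoeff (p +ₚ q) a n ≡ mulCoeff p a n ℚ.+ mulCoeff q a n
mulCoeff-+ₚ []      q       a n       = sym (ℚ.+-identityˡ _)
mulCoeff-+ₚ (c ∷ p) []      a n       = sym (ℚ.+-identityʳ _)
mulCoeff-+ₚ (c ∷ p) (d ∷ q) a zero    = ℚ.*-distribʳ-+ (a 0) c d
mulCoeff-+ₚ (c ∷ p) (d ∷ q) a (suc n) rewrite mulCoeff-+ₚ p q a n =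
  solve 5 (λ c d x u v → (c :+ d) :* x :+ (u :+ v) := (c :* x :+ u) :+ (d :* x :+ v))
          refl c d (a (suc n)) (mulCoeff p a n) (mulCoeff q a n)

mulCoeff-·ₚ : ∀ c p (a : Series) n → mulCoeff (c ·ₚ p) a n ≡ c ℚ.* mulCoeff p a n
mulCoeff-·ₚ c []      a n       = sym (ℚ.*-zeroʳ c)
mulCoeff-·ₚ c (d ∷ p) a zero    = ℚ.*-assoc c d (a 0)
mulCoeff-·ₚ c (d ∷ p) a (suc n) rewrite mulCoeff-·ₚ c p a n =
  solve 4 (λ c d x u → c :* d :* x :+ c :* u := c :* (d :* x :+ u)) refl c d (a (suc n)) (mulCoeff p a n)

mulCoeff-∷ : ∀ c p (a : Series) n → mulCoeff (c ∷ p) a n ≡ c ℚ.* a n ℚ.+ shift 1 (mulCoeff p a) n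
mulCoeff-∷ c p a zero    = sym (ℚ.+-identityʳ _)
mulCoeff-∷ c p a (suc n) = refl

mulCoeff-*ₚ : ∀ p q (a : Series) n → mulCoeff (p *ₚ q) a n ≡ mulCoeff p (mulCoeff q a) n
mulCoeff-*ₚ []      q a n = refl
mulCoeff-*ₚ (c ∷ p) q a n = begin
  mulCoeff (c ·ₚ q +ₚ (0ℚ ∷ p *ₚ q)) a n                               ≡⟨ mulCoeff-+ₚ (c ·ₚ q) _ a n ⟩
  mulCoeff (c ·ₚ q) a n ℚ.+ mulCoeff (0ℚ ∷ p *ₚ q) a n                 ≡⟨ cong₂ ℚ._+_ (mulCoeff-·ₚ c q a n) (mulCoeff-∷ 0ℚ (p *ₚ q) a n) ⟩
  c ℚ.* mulCoeff q a n ℚ.+ (0ℚ ℚ.* a n ℚ.+ shift 1 (mulCoeff (p *ₚ q) a) n)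
      ≡⟨ cong (c ℚ.* mulCoeff q a n ℚ.+_) (trans (cong (ℚ._+ shift 1 (mulCoeff (p *ₚ q) a) n) (ℚ.*-zeroˡ (a n))) (ℚ.+-identityˡ _)) ⟩
  c ℚ.* mulCoeff q a n ℚ.+ shift 1 (mulCoeff (p *ₚ q) a) n             ≡⟨ cong (c ℚ.* mulCoeff q a n ℚ.+_) (shift1-cong n) ⟩
  c ℚ.* mulCoeff q a n ℚ.+ shift 1 (mulCoeff p (mulCoeff q a)) n       ≡⟨ mulCoeff-∷ c p (mulCoeff q a) n ⟨
  mulCoeff (c ∷ p) (mulCoeff q a) n                                    ∎
  where
  open ≡-Reasoning
  shift1-cong : shift 1 (mulCoeff (p *ₚ q) a) ≗ shift 1 (mulCoeff p (mulCoeff q a))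
  shift1-cong zero    = refl
  shift1-cong (suc n) = mulCoeff-*ₚ p q a n

mulCoeff-monomial : ∀ t c (a : Series) n → mulCoeff (monomial t c) a n ≡ c ℚ.* shift t a n
mulCoeff-monomial zero    c a zero    = refl
mulCoeff-monomial zero    c a (suc n) = ℚ.+-identityʳ _
mulCoeff-monomial (suc t) c a zero    = trans (ℚ.*-zeroˡ (a 0)) (sym (ℚ.*-zeroʳ c))
mulCoeff-monomial (suc t) c a (suc n) =
  trans (cong (ℚ._+ mulCoeff (monomial t c) a n) (ℚ.*-zeroˡ (a (suc n)))) (trans (ℚ.+-identityˡ _) (mulCoeff-monomial t c a n))

mulCoeff-∑ₚ : ∀ N f (a : Series) n → mulCoeff (∑ₚ N f) a n ≡ ℚΣ.sum (λ i → mulCoeff (f i) a n)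
mulCoeff-∑ₚ zero    f a n = refl
mulCoeff-∑ₚ (suc N) f a n =
  trans (mulCoeff-+ₚ (f zero) _ a n) (cong (mulCoeff (f zero) a n ℚ.+_) (mulCoeff-∑ₚ N (f ∘ suc) a n))

constantTerm-+ₚ : ∀ p q → constantTerm (p +ₚ q) ≡ constantTerm p ℚ.+ constantTerm q
constantTerm-+ₚ []      q       = sym (ℚ.+-identityˡ _)
constantTerm-+ₚ (c ∷ p) []      = sym (ℚ.+-identityʳ _)
constantTerm-+ₚ (c ∷ p) (d ∷ q) = refl

constantTerm-*ₚ : ∀ p q → constantTerm (p *ₚ q) ≡ constantTerm p ℚ.* constantTerm q
constantTerm-*ₚ []      q       = sym (ℚ.*-zeroˡ (constantTerm q))
constantTerm-*ₚ (c ∷ p) []      = sym (ℚ.*-zeroʳ c)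
constantTerm-*ₚ (c ∷ p) (d ∷ q) = ℚ.+-identityʳ (c ℚ.* d)

constantTerm-∑ₚ : ∀ N f → (∀ i → constantTerm (f i) ≡ 0ℚ) → constantTerm (∑ₚ N f) ≡ 0ℚ
constantTerm-∑ₚ zero    f _  = refl
constantTerm-∑ₚ (suc N) f f0 =
  trans (constantTerm-+ₚ (f zero) _) (trans (cong₂ ℚ._+_ (f0 zero) (constantTerm-∑ₚ N (f ∘ suc) (f0 ∘ suc))) (ℚ.+-identityˡ 0ℚ))

EventuallyZero-cong : ∀ {a b : Series} → a ≗ b → EventuallyZero a → EventuallyZero b
EventuallyZero-cong a≗b (M , a≡0) = M , λ n le → trans (sym (a≗b n)) (a≡0 n le)

EventuallyZero-+ : ∀ {a b : Series} → EventuallyZero a → EventuallyZero b → EventuallyZero (λ n → a n ℚ.+ b n)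
EventuallyZero-+ (M , a≡0) (M′ , b≡0) = M ⊔ M′ , λ n le →
  trans (cong₂ ℚ._+_ (a≡0 n (ℕ.≤-trans (ℕ.m≤m⊔n M M′) le)) (b≡0 n (ℕ.≤-trans (ℕ.m≤n⊔m M M′) le))) (ℚ.+-identityˡ 0ℚ)

EventuallyZero-shift : ∀ t {a : Series} → EventuallyZero a → EventuallyZero (shift t a)
EventuallyZero-shift zero    a₀ = a₀
EventuallyZero-shift (suc t) a₀ with EventuallyZero-shift t a₀
... | M , sa≡0 = suc M , λ { (suc n) (s≤s le) → sa≡0 n le }

prefix : ℕ → Series → Polynomial
prefix zero    a = []
prefix (suc M) a = a 0 ∷ prefix M (a ∘ suc)

coeff-prefix-< : ∀ M a n → n < M → coeff (prefix M a) n ≡ a n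
coeff-prefix-< (suc M) a zero    _       = refl
coeff-prefix-< (suc M) a (suc n) (s≤s p) = coeff-prefix-< M (a ∘ suc) n p

coeff-prefix-≥ : ∀ M a n → M ≤ n → coeff (prefix M a) n ≡ 0ℚ
coeff-prefix-≥ zero    a n       _       = refl
coeff-prefix-≥ (suc M) a (suc n) (s≤s p) = coeff-prefix-≥ M (a ∘ suc) n p

module Localisation (L : Polynomial) where

  L^ : ℕ → Polynomial
  L^ zero    = 1ℚ ∷ []
  L^ (suc j) = L^ j *ₚ L

  -- a = P / L^j for a polynomial P; asking this for all large j makes sums easy.
  InLocalisation : Series → Set
  InLocalisation a = ∃ λ j₀ → ∀ j → j₀ ≤ j → EventuallyZero (mulCoeff (L^ j) a)

  InLocalisation-cong : ∀ {a b} → a ≗ b → InLocalisation a → InLocalisation b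
  InLocalisation-cong a≗b (j₀ , La) = j₀ , λ j le → EventuallyZero-cong (mulCoeff-cong (L^ j) a≗b) (La j le)

  EventuallyZero⇒InLocalisation : ∀ {a} → EventuallyZero a → InLocalisation a
  EventuallyZero⇒InLocalisation a₀ = 0 , λ j _ → mulCoeff-EventuallyZero (L^ j) a₀

  InLocalisation-0 : InLocalisation (λ _ → 0ℚ)
  InLocalisation-0 = EventuallyZero⇒InLocalisation (0 , λ _ _ → refl)

  InLocalisation-+ : ∀ {a b} → InLocalisation a → InLocalisation b → InLocalisation (λ n → a n ℚ.+ b n)
  InLocalisation-+ {a} {b} (j₀ , La) (j₁ , Lb) = j₀ ⊔ j₁ , λ j le →
    EventuallyZero-cong (λ n → sym (mulCoeff-+ (L^ j) a b n))
      (EventuallyZero-+ (La j (ℕ.≤-trans (ℕ.m≤m⊔n j₀ j₁) le)) (Lb j (ℕ.≤-trans (ℕ.m≤n⊔m j₀ j₁) le)))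

  InLocalisation-∑ : ∀ N (a : Fin N → Series) → (∀ i → InLocalisation (a i)) →
                     InLocalisation (λ n → ℚΣ.sum (λ i → a i n))
  InLocalisation-∑ zero    a _  = InLocalisation-0
  InLocalisation-∑ (suc N) a La = InLocalisation-+ (La zero) (InLocalisation-∑ N (a ∘ suc) (La ∘ suc))

  InLocalisation-shift : ∀ t {a} → InLocalisation a → InLocalisation (shift t a)
  InLocalisation-shift t {a} (j₀ , La) = j₀ , λ j le →
    EventuallyZero-cong (λ n → sym (mulCoeff-shift (L^ j) t a n)) (EventuallyZero-shift t (La j le))

  InLocalisation-if : ∀ {P : Set} (P? : Dec P) {a} → (P → InLocalisation a) →
                      InLocalisation (λ n → if does P? then a n else 0ℚ)
  InLocalisation-if (yes p) La = La p
  InLocalisation-if (no _)  _  = InLocalisation-0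

  InLocalisation-step : ∀ {a g} → mulCoeff L a ≗ g → InLocalisation g → InLocalisation a
  InLocalisation-step {a} La≗g (j₀ , Lg) = suc j₀ , λ where
    (suc j) (s≤s le) → EventuallyZero-cong (λ n → sym (trans (mulCoeff-*ₚ (L^ j) L a n) (mulCoeff-cong (L^ j) La≗g n)))
                                           (Lg j le)

  constantTerm-L^ : constantTerm L ≡ 1ℚ → ∀ j → constantTerm (L^ j) ≡ 1ℚ
  constantTerm-L^ L₀ zero    = refl
  constantTerm-L^ L₀ (suc j) =
    trans (constantTerm-*ₚ (L^ j) L) (trans (cong₂ ℚ._*_ (constantTerm-L^ L₀ j) L₀) (ℚ.*-identityˡ 1ℚ))

  InLocalisation⇒IsRationalGF : constantTerm L ≡ 1ℚ → ∀ J → InLocalisation (toℚ ∘ J) → IsRationalGF J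
  InLocalisation⇒IsRationalGF L₀ J (j₀ , LJ) =
    prefix M (mulCoeff (L^ j₀) (toℚ ∘ J)) , L^ j₀ , nonzero (L^ j₀) (constantTerm-L^ L₀ j₀) , numerator
    where
    M : ℕ
    M = proj₁ (LJ j₀ ℕ.≤-refl)
    nonzero : ∀ Q → constantTerm Q ≡ 1ℚ → Any (_≢ 0ℚ) Q
    nonzero (c ∷ Q) c≡1 = here (λ c≡0 → ℚ.1≢0 (trans (sym c≡1) c≡0))
    numerator : ∀ n → mulCoeff (L^ j₀) (toℚ ∘ J) n ≡ coeff (prefix M (mulCoeff (L^ j₀) (toℚ ∘ J))) n
    numerator n with n <? M
    ... | yes n<M = sym (coeff-prefix-< M _ n n<M)
    ... | no  n≮M = trans (proj₂ (LJ j₀ ℕ.≤-refl) n (ℕ.≮⇒≥ n≮M)) (sym (coeff-prefix-≥ M _ n (ℕ.≮⇒≥ n≮M)))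

-- Card sequences as stacks of rows

module _ (k : ℕ) where

  -- n is the sum of the last row of the stack and d the deficit of this row.  Side conditions
  -- are squashed throughout, so that the bijections below are inverse on them definitionally.
  Row : ℕ → ℕ → List ℕ → Set
  Row d n γ = Squash (All (PartOK k) γ × sum γ + d ≡ n)

  Rows : ∀ {ℓ} → Vec Mode ℓ → Vec ℕ ℓ → ℕ → List ℕ → Set
  Rows []       []       n γ = Row 0 n γ
  Rows (m ∷ ms) (d ∷ ds) n γ = Row d n γ × Σ (List ℕ) λ β → Link m γ β × Rows ms ds n β

  module _ (b : ℕ) where

    CompBK? : ∀ γ → Dec (CompBK b k γ)
    CompBK? γ = all? (λ x → (1 ≤? x) ×-dec (x ≤? k)) γ ×-dec (sum γ ≟ b)

    CompBK-irrelevant : ∀ {γ} → Irrelevant (CompBK b k γ)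
    CompBK-irrelevant (p , e) (p′ , e′) =
      cong₂ _,_ (All.irrelevant (λ (l , u) (l′ , u′) → cong₂ _,_ (ℕ.≤-irrelevant l l′) (ℕ.≤-irrelevant u u′)) p p′)
                (ℕ.≡-irrelevant e e′)

    CompBK↔Row : ∀ {γ} → CompBK b k γ ↔ Row 0 b γ
    CompBK↔Row {γ} =
      mk↔ₛ′ (λ (p , e) → [ p , trans (ℕ.+-identityʳ (sum γ)) e ])
            (λ { [ r ] → recompute (CompBK? γ) (proj₁ r , trans (sym (ℕ.+-identityʳ (sum γ))) (proj₂ r)) })
            (λ _ → refl) (λ _ → CompBK-irrelevant _ _)

    StartsAt : List ℕ → List (Card b k) → Set
    StartsAt γ []      = ⊤
    StartsAt γ (c ∷ _) = γ ≡ Card.arr c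

    CardsFrom : ℕ → List ℕ → Set
    CardsFrom ℓ γ = Σ (List (Card b k)) λ cs → length cs ≡ ℓ × Linked Chains cs × StartsAt γ cs

    Linked-Chains-∷ : ∀ {c cs} → Linked Chains (c ∷ cs) ↔ (Linked Chains cs × StartsAt (Card.dep c) cs)
    Linked-Chains-∷ {c} {cs} = mk↔ₛ′ to from to∘from from∘to
      where
      to : ∀ {cs} → Linked Chains (c ∷ cs) → Linked Chains cs × StartsAt (Card.dep c) cs
      to [-]      = [] , tt
      to (p ∷ lk) = lk , p
      from : ∀ {cs} → Linked Chains cs × StartsAt (Card.dep c) cs → Linked Chains (c ∷ cs)
      from {[]}    _        = [-]
      from {_ ∷ _} (lk , p) = p ∷ lk
      to∘from : ∀ {cs} x → to {cs} (from x) ≡ x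
      to∘from {[]}    ([] , tt) = refl
      to∘from {_ ∷ _} _         = refl
      from∘to : ∀ {cs} x → from {cs} (to x) ≡ x
      from∘to [-]     = refl
      from∘to (_ ∷ _) = refl

    FirstCard : ℕ → List ℕ → Set
    FirstCard ℓ γ = Σ (List ℕ) λ β → Labelling (Fits β) γ × CompBK b k β × CardsFrom ℓ β

    CardsFrom-suc : ∀ {ℓ γ} → (CompBK b k γ × CardsFrom (suc ℓ) γ) ↔ (CompBK b k γ × FirstCard ℓ γ)
    CardsFrom-suc {ℓ} {γ} = mk↔ₛ′ to from to∘from from∘to
      where
      to : CompBK b k γ × CardsFrom (suc ℓ) γ → CompBK b k γ × FirstCard ℓ γ
      to (p , card _ β _ q f f-inc f-fits ∷ cs , len , lk , refl) =
        p , β , (f , f-inc , f-fits) , q , cs , ℕ.suc-injective len , Inverse.to Linked-Chains-∷ lk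
      from : CompBK b k γ × FirstCard ℓ γ → CompBK b k γ × CardsFrom (suc ℓ) γ
      from (p , β , (f , f-inc , f-fits) , q , cs , len , lk) =
        p , card γ β p q f f-inc f-fits ∷ cs , cong suc len , Inverse.from Linked-Chains-∷ lk , refl
      to∘from : ∀ x → to (from x) ≡ x
      to∘from (p , β , lab , q , cs , len , lk) =
        cong₂ (λ e l → p , β , lab , q , cs , e , l) (ℕ.≡-irrelevant _ _) (Inverse.strictlyInverseˡ Linked-Chains-∷ lk)
      from∘to : ∀ x → from (to x) ≡ x
      from∘to (p , card _ β p′ q f f-inc f-fits ∷ cs , len , lk , refl)
        rewrite CompBK-irrelevant p p′ | ℕ.≡-irrelevant (cong suc (ℕ.suc-injective len)) len
              | Inverse.strictlyInverseʳ (Linked-Chains-∷ {card γ β p′ q f f-inc f-fits} {cs}) lk = refl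

    CardsFrom↔Rows : ∀ ℓ {γ} → (CompBK b k γ × CardsFrom ℓ γ) ↔ Σ (Vec Mode ℓ) λ ms → Rows ms (replicate ℓ 0) b γ
    CardsFrom↔Rows zero =
      mk↔ₛ′ (λ (p , _) → [] , Inverse.to CompBK↔Row p)
            (λ { ([] , r) → Inverse.from CompBK↔Row r , [] , refl , [] , tt })
            (λ { ([] , _) → refl })
            (λ { (p , [] , refl , [] , tt) → cong (_, _) (CompBK-irrelevant _ _) })
    CardsFrom↔Rows (suc ℓ) {γ} =
      CardsFrom-suc
      ⨾ (↔-refl ×-↔ Σ-↔ ↔-refl (λ {β} → Labelling-Fits↔Link β γ ×-↔ CardsFrom↔Rows ℓ))
      ⨾ mk↔ₛ′ (λ (p , β , (m , l) , (ms , r)) → m ∷ ms , Inverse.to CompBK↔Row p , β , l , r)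
              (λ { (m ∷ ms , row , β , l , r) → Inverse.from CompBK↔Row row , β , (m , l) , (ms , r) })
              (λ { (_ ∷ _ , _) → refl })
              (λ _ → cong (_, _) (CompBK-irrelevant _ _))

    CardSeq↔Rows : ∀ ℓ → CardSeq b k (suc ℓ) ↔ Σ (Vec Mode (suc ℓ)) λ ms → Σ (List ℕ) (Rows ms (replicate (suc ℓ) 0) b)
    CardSeq↔Rows ℓ =
      mk↔ₛ′ (λ { (c ∷ cs , len , lk) → Card.arr c , Card.arrOK c , c ∷ cs , len , lk , refl })
            (λ (_ , _ , cs , len , lk , _) → cs , len , lk)
            (λ { (γ , p , c ∷ cs , len , lk , refl) → cong (λ q → γ , q , c ∷ cs , len , lk , refl) (CompBK-irrelevant _ _) })
            (λ { (_ ∷ _ , _ , _) → refl })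
      ⨾ Σ-↔ ↔-refl (CardsFrom↔Rows (suc ℓ))
      ⨾ ∃∃↔∃∃ _

  infixr 5 _∷?_
  _∷?_ : Maybe ℕ → List ℕ → List ℕ
  nothing ∷? γ = γ
  just v  ∷? γ = v ∷ γ

  -- The first column of a stack, indexed by its cell in the top row.  It removes the first part of
  -- each row of a block ending at the last row (last) or at the arrival row of the first pending
  -- link (drop); inside the block each part is matched to the one below it, and the row just
  -- above the block skips the block's top part.
  data Column : ∀ {ℓ} → Vec Mode ℓ → Maybe ℕ → Set where
    last   : ∀ {v} → .(PartOK k v) → Column [] (just v)
    drop   : ∀ {ℓ} {ms : Vec Mode ℓ} {v} → .(PartOK k v) → Column (pending ∷ ms) (just v)
    absent : ∀ {ℓ} {ms : Vec Mode ℓ} → Column ms nothing → Column (matched ∷ ms) nothing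
    skip   : ∀ {ℓ} {ms : Vec Mode ℓ} {w} → Column ms (just w) → Column (matched ∷ ms) nothing
    match  : ∀ {ℓ} {ms : Vec Mode ℓ} {w a} → .(1 ≤ a) → a ≤ w → Column ms (just w) → Column (matched ∷ ms) (just a)

  Columns : ∀ {ℓ} → Vec Mode ℓ → Set
  Columns ms = Σ (Maybe ℕ) (Column ms)

  lastPart : ∀ {ℓ} {ms : Vec Mode ℓ} {c} → Column ms c → ℕ
  lastPart (last {v} _)  = v
  lastPart (drop _)      = 0
  lastPart (absent x)    = lastPart x
  lastPart (skip x)      = lastPart x
  lastPart (match _ _ x) = lastPart x

  modesAfter : ∀ {ℓ} {ms : Vec Mode ℓ} {c} → Column ms c → Vec Mode ℓ
  modesAfter (last _)           = []
  modesAfter (drop {ms = ms} _) = matched ∷ ms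
  modesAfter (absent x)         = matched ∷ modesAfter x
  modesAfter (skip x)           = matched ∷ modesAfter x
  modesAfter (match _ _ x)      = matched ∷ modesAfter x

  deficitsAfter : ∀ {ℓ} {ms : Vec Mode ℓ} {c} → Column ms c → Vec ℕ ℓ → Vec ℕ ℓ
  deficitsAfter (last _)              []       = []
  deficitsAfter (drop {v = v} _)      (d ∷ ds) = v + d ∷ ds
  deficitsAfter (absent x)            (d ∷ ds) = d ∸ lastPart x ∷ deficitsAfter x ds
  deficitsAfter (skip x)              (d ∷ ds) = d ∸ lastPart x ∷ deficitsAfter x ds
  deficitsAfter (match {a = a} _ _ x) (d ∷ ds) = a + d ∸ lastPart x ∷ deficitsAfter x ds

  -- None of the new deficits is a truncated subtraction.
  DeficitsFit : ∀ {ℓ} {ms : Vec Mode ℓ} {c} → Column ms c → Vec ℕ ℓ → Set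
  DeficitsFit (last _)              []       = ⊤
  DeficitsFit (drop _)              _        = ⊤
  DeficitsFit (absent x)            (d ∷ ds) = lastPart x ≤ d × DeficitsFit x ds
  DeficitsFit (skip x)              (d ∷ ds) = lastPart x ≤ d × DeficitsFit x ds
  DeficitsFit (match {a = a} _ _ x) (d ∷ ds) = lastPart x ≤ a + d × DeficitsFit x ds

  Admissible : ∀ {ℓ} {ms : Vec Mode ℓ} {c} → Column ms c → Vec ℕ ℓ → ℕ → Set
  Admissible x ds n = lastPart x ≤ n × DeficitsFit x ds

  DeficitsFit? : ∀ {ℓ} {ms : Vec Mode ℓ} {c} (x : Column ms c) ds → Dec (DeficitsFit x ds)
  DeficitsFit? (last _)              []       = yes tt
  DeficitsFit? (drop _)              _        = yes tt
  DeficitsFit? (absent x)            (d ∷ ds) = (lastPart x ≤? d) ×-dec DeficitsFit? x ds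
  DeficitsFit? (skip x)              (d ∷ ds) = (lastPart x ≤? d) ×-dec DeficitsFit? x ds
  DeficitsFit? (match {a = a} _ _ x) (d ∷ ds) = (lastPart x ≤? a + d) ×-dec DeficitsFit? x ds

  Admissible? : ∀ {ℓ} {ms : Vec Mode ℓ} {c} (x : Column ms c) ds n → Dec (Admissible x ds n)
  Admissible? x ds n = (lastPart x ≤? n) ×-dec DeficitsFit? x ds

  EmptyRows : ∀ {ℓ} → Vec Mode ℓ → Vec ℕ ℓ → ℕ → List ℕ → Set
  EmptyRows ms ds n []      = Squash (Exhausted ms ds n)
  EmptyRows ms ds n (_ ∷ _) = ⊥

  FirstColumn : ∀ {ℓ} → Vec Mode ℓ → Vec ℕ ℓ → ℕ → List ℕ → Set
  FirstColumn ms ds n γ =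
    Σ (Columns ms) λ (c , x) → Σ (List ℕ) λ γ′ → γ ≡ c ∷? γ′ ×
      Squash (Admissible x ds n) × Rows (modesAfter x) (deficitsAfter x ds) (n ∸ lastPart x) γ′

  Rows-sum-≤ : ∀ {ℓ} {ms : Vec Mode ℓ} {ds n β} → Rows ms ds n β → sum β ≤ n
  Rows-sum-≤ {ms = []}    {[]}    {n} {β} [ r ]     = recompute (sum β ≤? n) (ℕ.m+n≤o⇒m≤o _ (ℕ.≤-reflexive (proj₂ r)))
  Rows-sum-≤ {ms = _ ∷ _} {_ ∷ _} {n} {β} ([ r ] , _) = recompute (sum β ≤? n) (ℕ.m+n≤o⇒m≤o _ (ℕ.≤-reflexive (proj₂ r)))

  Column-top-≤ : ∀ {ℓ} {ms : Vec Mode ℓ} {w} → Column ms (just w) → w ≤ k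
  Column-top-≤ {w = w} (last p) = recompute (w ≤? k) (proj₂ p)
  Column-top-≤ {w = w} (drop p) = recompute (w ≤? k) (proj₂ p)
  Column-top-≤ (match _ le x)   = ℕ.≤-trans le (Column-top-≤ x)

  Rows-step-last : ∀ n γ → Row 0 n γ ↔ (EmptyRows [] [] n γ ⊎ FirstColumn [] [] n γ)
  Rows-step-last n [] =
    mk↔ₛ′ (λ { [ r ] → inj₁ [ sym (proj₂ r) , refl , refl ] })
          (λ { (inj₁ [ e ]) → [ [] , sym (proj₁ e) ] ; (inj₂ ((just _ , last _) , _ , () , _)) })
          (λ { (inj₁ _) → refl ; (inj₂ ((just _ , last _) , _ , () , _)) })
          (λ _ → refl)
  Rows-step-last n (a ∷ γ) = mk↔ₛ′ to from to∘from (λ _ → refl)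
    where
    to : Row 0 n (a ∷ γ) → EmptyRows [] [] n (a ∷ γ) ⊎ FirstColumn [] [] n (a ∷ γ)
    to [ r ] = inj₂ ((just a , last (All.head (proj₁ r))) , γ , refl ,
                     [ proj₁ (+≡⇒≡∸ {a} (trans (sym (ℕ.+-assoc a (sum γ) 0)) (proj₂ r))) , tt ] ,
                     [ All.tail (proj₁ r) , proj₂ (+≡⇒≡∸ {a} (trans (sym (ℕ.+-assoc a (sum γ) 0)) (proj₂ r))) ])
    from : EmptyRows [] [] n (a ∷ γ) ⊎ FirstColumn [] [] n (a ∷ γ) → Row 0 n (a ∷ γ)
    from (inj₂ ((just _ , last p) , _ , refl , [ adm ] , [ r ])) =
      [ p ∷ proj₁ r , trans (ℕ.+-assoc a (sum γ) 0) (≡∸⇒+≡ {a} (proj₁ adm) (proj₂ r)) ]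
    to∘from : ∀ x → to (from x) ≡ x
    to∘from (inj₂ ((just _ , last _) , _ , refl , [ _ ] , [ _ ])) = refl

  Rows-step-pending : ∀ {ℓ} (ms : Vec Mode ℓ) d ds n γ →
    Rows (pending ∷ ms) (d ∷ ds) n γ ↔ (EmptyRows (pending ∷ ms) (d ∷ ds) n γ ⊎ FirstColumn (pending ∷ ms) (d ∷ ds) n γ)
  Rows-step-pending ms d ds n [] =
    mk↔ₛ′ (λ { (_ , _ , () , _) })
          (λ { (inj₁ [ e ]) → ⊥-elim-irr (ℕ.1+n≢0 (proj₂ (proj₂ e))) ; (inj₂ ((just _ , drop _) , _ , () , _)) })
          (λ { (inj₁ [ e ]) → ⊥-elim-irr (ℕ.1+n≢0 (proj₂ (proj₂ e))) ; (inj₂ ((just _ , drop _) , _ , () , _)) })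
          (λ { (_ , _ , () , _) })
  Rows-step-pending ms d ds n (a ∷ γ) = mk↔ₛ′ to from to∘from (λ { ([ _ ] , _) → refl })
    where
    to : Rows (pending ∷ ms) (d ∷ ds) n (a ∷ γ) →
         EmptyRows (pending ∷ ms) (d ∷ ds) n (a ∷ γ) ⊎ FirstColumn (pending ∷ ms) (d ∷ ds) n (a ∷ γ)
    to ([ r ] , rest) = inj₂ ((just a , drop (All.head (proj₁ r))) , γ , refl , [ z≤n , tt ] ,
                              [ All.tail (proj₁ r) , trans (sym (+-exchange a (sum γ) d)) (proj₂ r) ] , rest)
    from : EmptyRows (pending ∷ ms) (d ∷ ds) n (a ∷ γ) ⊎ FirstColumn (pending ∷ ms) (d ∷ ds) n (a ∷ γ) →
           Rows (pending ∷ ms) (d ∷ ds) n (a ∷ γ)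
    from (inj₂ ((just _ , drop p) , _ , refl , _ , [ r ] , rest)) =
      [ p ∷ proj₁ r , trans (+-exchange a (sum γ) d) (proj₂ r) ] , rest
    to∘from : ∀ x → to (from x) ≡ x
    to∘from (inj₂ ((just _ , drop _) , _ , refl , [ _ ] , [ _ ] , _)) = refl

  Matching-Rows-≤ : ∀ {ℓ} {ms : Vec Mode ℓ} {ds n γ β} → Matching γ β → Rows ms ds n β → sum γ ≤ n
  Matching-Rows-≤ m rows = ℕ.≤-trans (Matching-sum-≤ m) (Rows-sum-≤ rows)

  module _ {ℓ} {ms : Vec Mode ℓ} {d : ℕ} {ds : Vec ℕ ℓ} {n : ℕ} where

    Rows-step-matched-empty : ∀ γ → (Row d n γ × Σ (List ℕ) λ β → Matching γ β × EmptyRows ms ds n β) ↔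
                                    EmptyRows (matched ∷ ms) (d ∷ ds) n γ
    Rows-step-matched-empty [] =
      mk↔ₛ′ (λ { ([ r ] , [] , [] , [ e ]) → [ proj₁ e , cong₂ _∷_ (trans (proj₂ r) (proj₁ e)) (proj₁ (proj₂ e)) , proj₂ (proj₂ e) ] })
            (λ { [ e ] → [ [] , trans (∷-injectiveˡ (proj₁ (proj₂ e))) (sym (proj₁ e)) ] , [] , [] ,
                         [ proj₁ e , ∷-injectiveʳ (proj₁ (proj₂ e)) , proj₂ (proj₂ e) ] })
            (λ _ → refl)
            (λ { ([ _ ] , [] , [] , [ _ ]) → refl })
    Rows-step-matched-empty (a ∷ γ) = mk↔ₛ′ (λ { (_ , [] , () , _) ; (_ , _ ∷ _ , _ , ()) }) (λ ()) (λ ())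
                                            (λ { (_ , [] , () , _) ; (_ , _ ∷ _ , _ , ()) })

    ColumnBelow : List ℕ → Set
    ColumnBelow γ = Row d n γ × Σ (List ℕ) λ β → Matching γ β × FirstColumn ms ds n β

    extendColumn : ∀ {γ} → ColumnBelow γ → FirstColumn (matched ∷ ms) (d ∷ ds) n γ
    extendColumn {γ} ([ r ] , β , m , (nothing , x) , _ , refl , [ adm ] , rows) =
      (nothing , absent x) , γ , refl ,
      [ proj₁ adm , proj₁ (row-shrink {0} (Matching-Rows-≤ m rows) (proj₁ adm) (proj₂ r)) , proj₂ adm ] ,
      [ proj₁ r , proj₂ (row-shrink {0} (Matching-Rows-≤ m rows) (proj₁ adm) (proj₂ r)) ] , β , m , rows
    extendColumn {γ} ([ r ] , _ , skip m , (just _ , x) , β , refl , [ adm ] , rows) =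
      (nothing , skip x) , γ , refl ,
      [ proj₁ adm , proj₁ (row-shrink {0} (Matching-Rows-≤ m rows) (proj₁ adm) (proj₂ r)) , proj₂ adm ] ,
      [ proj₁ r , proj₂ (row-shrink {0} (Matching-Rows-≤ m rows) (proj₁ adm) (proj₂ r)) ] , β , m , rows
    extendColumn {a ∷ γ} ([ r ] , _ , match le m , (just _ , x) , β , refl , [ adm ] , rows) =
      (just a , match (proj₁ (All.head (proj₁ r))) le x) , γ , refl ,
      [ proj₁ adm , proj₁ (row-shrink {a} (Matching-Rows-≤ m rows) (proj₁ adm) (proj₂ r)) , proj₂ adm ] ,
      [ All.tail (proj₁ r) , proj₂ (row-shrink {a} (Matching-Rows-≤ m rows) (proj₁ adm) (proj₂ r)) ] , β , m , rows

    restrictColumn : ∀ {γ} → FirstColumn (matched ∷ ms) (d ∷ ds) n γ → ColumnBelow γ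
    restrictColumn ((nothing , absent x) , γ , refl , [ adm ] , [ r ] , β , m , rows) =
      [ proj₁ r , row-grow {0} (proj₁ adm) (proj₁ (proj₂ adm)) (proj₂ r) ] , β , m ,
      (nothing , x) , β , refl , [ proj₁ adm , proj₂ (proj₂ adm) ] , rows
    restrictColumn ((nothing , skip {w = w} x) , γ , refl , [ adm ] , [ r ] , β , m , rows) =
      [ proj₁ r , row-grow {0} (proj₁ adm) (proj₁ (proj₂ adm)) (proj₂ r) ] , w ∷ β , skip m ,
      (just w , x) , β , refl , [ proj₁ adm , proj₂ (proj₂ adm) ] , rows
    restrictColumn ((just a , match {w = w} 1≤a le x) , γ , refl , [ adm ] , [ r ] , β , m , rows) =
      [ (1≤a , ℕ.≤-trans le (Column-top-≤ x)) ∷ proj₁ r , row-grow {a} (proj₁ adm) (proj₁ (proj₂ adm)) (proj₂ r) ] ,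
      w ∷ β , match le m , (just w , x) , β , refl , [ proj₁ adm , proj₂ (proj₂ adm) ] , rows

    Rows-step-matched-column : ∀ γ → ColumnBelow γ ↔ FirstColumn (matched ∷ ms) (d ∷ ds) n γ
    Rows-step-matched-column γ = mk↔ₛ′ extendColumn restrictColumn extend∘restrict restrict∘extend
      where
      extend∘restrict : ∀ {γ} (y : FirstColumn (matched ∷ ms) (d ∷ ds) n γ) → extendColumn (restrictColumn y) ≡ y
      extend∘restrict ((nothing , absent _) , _ , refl , [ _ ] , [ _ ] , _)   = refl
      extend∘restrict ((nothing , skip _) , _ , refl , [ _ ] , [ _ ] , _)     = refl
      extend∘restrict ((just _ , match _ _ _) , _ , refl , [ _ ] , [ _ ] , _) = refl

      restrict∘extend : ∀ {γ} (y : ColumnBelow γ) → restrictColumn (extendColumn y) ≡ y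
      restrict∘extend ([ _ ] , _ , _ , (nothing , absent _) , _ , refl , [ _ ] , _)  = refl
      restrict∘extend ([ _ ] , _ , _ , (nothing , skip _) , _ , refl , [ _ ] , _)    = refl
      restrict∘extend ([ _ ] , _ , skip _ , (just _ , _) , _ , refl , [ _ ] , _)     = refl
      restrict∘extend ([ _ ] , _ , match _ _ , (just _ , _) , _ , refl , [ _ ] , _) = refl

  Rows-step : ∀ {ℓ} (ms : Vec Mode ℓ) ds n γ → Rows ms ds n γ ↔ (EmptyRows ms ds n γ ⊎ FirstColumn ms ds n γ)
  Rows-step []             []       n γ = Rows-step-last n γ
  Rows-step (pending ∷ ms) (d ∷ ds) n γ = Rows-step-pending ms d ds n γ
  Rows-step (matched ∷ ms) (d ∷ ds) n γ =
    (↔-refl ×-↔ Σ-↔ ↔-refl (↔-refl ×-↔ Rows-step ms ds n _))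
    ⨾ (↔-refl ×-↔ (Σ-↔ ↔-refl ×-distribˡ-⊎ ⨾ Σ-distribˡ-⊎))
    ⨾ ×-distribˡ-⊎
    ⨾ (Rows-step-matched-empty γ ⊎-↔ Rows-step-matched-column γ)

  -- Counting stacks

  MatchValue : ℕ → Set
  MatchValue w = Σ ℕ λ a → Squash (1 ≤ a) × a ≤ w

  Extension : Maybe ℕ → Set
  Extension nothing  = ⊤
  Extension (just w) = ⊤ ⊎ MatchValue w

  extensionSize : Maybe ℕ → ℕ
  extensionSize nothing  = 1
  extensionSize (just w) = 1 + w

  Extension↔Fin : ∀ c → Extension c ↔ Fin (extensionSize c)
  Extension↔Fin nothing  = ↔-sym 1↔⊤
  Extension↔Fin (just w) = (↔-sym 1↔⊤ ⊎-↔ MatchValue↔Fin) ⨾ ↔-sym +↔⊎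
    where
    MatchValue↔Fin : MatchValue w ↔ Fin w
    MatchValue↔Fin =
      mk↔ₛ′ (λ (a , [ p ] , q) → a , [ p , q ])
            (λ { (a , [ pq ]) → a , [ proj₁ pq ] , recompute (a ≤? w) (proj₂ pq) })
            (λ _ → refl)
            (λ (a , [ p ] , q) → cong (λ q → a , [ p ] , q) (ℕ.≤-irrelevant _ _))
      ⨾ Interval↔Fin w

  Columns-matched : ∀ {ℓ} {ms : Vec Mode ℓ} → Columns (matched ∷ ms) ↔ Σ (Columns ms) (Extension ∘ proj₁)
  Columns-matched = mk↔ₛ′ to from to∘from from∘to
    where
    to : Columns (matched ∷ _) → Σ (Columns _) (Extension ∘ proj₁)
    to (nothing , absent x)    = (nothing , x) , tt
    to (nothing , skip x)      = (just _ , x) , inj₁ tt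
    to (just a , match p le x) = (just _ , x) , inj₂ (a , [ p ] , le)
    from : Σ (Columns _) (Extension ∘ proj₁) → Columns (matched ∷ _)
    from ((nothing , x) , tt)                   = nothing , absent x
    from ((just w , x) , inj₁ tt)               = nothing , skip x
    from ((just w , x) , inj₂ (a , [ p ] , le)) = just a , match p le x
    to∘from : ∀ y → to (from y) ≡ y
    to∘from ((nothing , x) , tt)                 = refl
    to∘from ((just w , x) , inj₁ tt)             = refl
    to∘from ((just w , x) , inj₂ (_ , [ _ ] , _)) = refl
    from∘to : ∀ x → from (to x) ≡ x
    from∘to (nothing , absent x)    = refl
    from∘to (nothing , skip x)      = refl
    from∘to (just a , match p le x) = refl

  Columns-finite : ∀ {ℓ} (ms : Vec Mode ℓ) → Σ ℕ λ N → Columns ms ↔ Fin N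
  Columns-finite [] =
    k , mk↔ₛ′ (λ { (just v , last p) → v , [ p ] }) (λ { (v , [ p ]) → just v , last p })
              (λ { (_ , [ _ ]) → refl }) (λ { (just _ , last _) → refl })
        ⨾ Interval↔Fin k
  Columns-finite (pending ∷ ms) =
    k , mk↔ₛ′ (λ { (just v , drop p) → v , [ p ] }) (λ { (v , [ p ]) → just v , drop p })
              (λ { (_ , [ _ ]) → refl }) (λ { (just _ , drop _) → refl })
        ⨾ Interval↔Fin k
  Columns-finite (matched ∷ ms) =
    _ , Columns-matched ⨾ Σ↔Fin-∑ (proj₂ (Columns-finite ms)) (extensionSize ∘ proj₁) (Extension↔Fin ∘ proj₁)

  column-cases : ∀ {ℓ} {ms : Vec Mode ℓ} {c} (x : Column ms c) →
                 (lastPart x ≡ 0 × suc (pendings (modesAfter x)) ≡ pendings ms) ⊎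
                 (1 ≤ lastPart x × modesAfter x ≡ ms × pendings ms ≡ 0)
  column-cases (last {v} p)  = inj₂ (recompute (1 ≤? v) (proj₁ p) , refl , refl)
  column-cases (drop _)      = inj₁ (refl , refl)
  column-cases (absent x)    = Sum.map₂ (λ (t , e , z) → t , cong (matched ∷_) e , z) (column-cases x)
  column-cases (skip x)      = Sum.map₂ (λ (t , e , z) → t , cong (matched ∷_) e , z) (column-cases x)
  column-cases (match _ _ x) = Sum.map₂ (λ (t , e , z) → t , cong (matched ∷_) e , z) (column-cases x)

  column-decreases : ∀ {ℓ} {ms : Vec Mode ℓ} {c} (x : Column ms c) {n f} → lastPart x ≤ n →
                     n + pendings ms < suc f → n ∸ lastPart x + pendings (modesAfter x) < f
  column-decreases x {n} t≤n lt with column-cases x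
  ... | inj₁ (t≡0 , p) rewrite t≡0 | sym p | ℕ.+-suc n (pendings (modesAfter x)) = s≤s⁻¹ lt
  ... | inj₂ (1≤t , e , z) rewrite e | z | ℕ.+-identityʳ n | ℕ.+-identityʳ (n ∸ lastPart x) =
    ℕ.<-≤-trans (ℕ.∸-monoʳ-< 1≤t t≤n) (s≤s⁻¹ lt)

  module _ {ℓ : ℕ} where

    Stacks : Vec Mode ℓ → Vec ℕ ℓ → ℕ → Set
    Stacks ms ds n = Σ (List ℕ) (Rows ms ds n)

    StacksAfter : ∀ {ms : Vec Mode ℓ} {c} → Column ms c → Vec ℕ ℓ → ℕ → Set
    StacksAfter x ds n = Stacks (modesAfter x) (deficitsAfter x ds) (n ∸ lastPart x)

    Stacks-step : ∀ ms ds n → Stacks ms ds n ↔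
                  (Squash (Exhausted ms ds n) ⊎ Σ (Columns ms) λ (_ , x) → Squash (Admissible x ds n) × StacksAfter x ds n)
    Stacks-step ms ds n = Σ-↔ ↔-refl (Rows-step ms ds n _) ⨾ Σ-distribˡ-⊎ ⨾ (empty ⊎-↔ column)
      where
      empty : Σ (List ℕ) (EmptyRows ms ds n) ↔ Squash (Exhausted ms ds n)
      empty = mk↔ₛ′ (λ { ([] , e) → e }) ([] ,_) (λ _ → refl) (λ { ([] , _) → refl })
      column : Σ (List ℕ) (FirstColumn ms ds n) ↔ Σ (Columns ms) λ (_ , x) → Squash (Admissible x ds n) × StacksAfter x ds n
      column = mk↔ₛ′ (λ { (_ , cx , γ , refl , adm , rows) → cx , adm , γ , rows })
                     (λ { ((c , x) , adm , γ , rows) → c ∷? γ , (c , x) , γ , refl , adm , rows })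
                     (λ _ → refl)
                     (λ { (_ , _ , _ , refl , _) → refl })

    columnCount : Vec Mode ℓ → ℕ
    columnCount ms = proj₁ (Columns-finite ms)

    column : ∀ ms → Fin (columnCount ms) → Columns ms
    column ms = Inverse.from (proj₂ (Columns-finite ms))

    columnTerm : (Vec Mode ℓ → Vec ℕ ℓ → ℕ → ℕ) → ∀ {ms} → Columns ms → Vec ℕ ℓ → ℕ → ℕ
    columnTerm C (_ , x) ds n =
      if does (Admissible? x ds n) then C (modesAfter x) (deficitsAfter x ds) (n ∸ lastPart x) else 0

    unfoldCount : (Vec Mode ℓ → Vec ℕ ℓ → ℕ → ℕ) → Vec Mode ℓ → Vec ℕ ℓ → ℕ → ℕ
    unfoldCount C ms ds n =
      (if does (Exhausted? ms ds n) then 1 else 0) + ∑[ i < columnCount ms ] columnTerm C (column ms i) ds n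

    Stacks↔Fin-unfold : ∀ C ms ds n →
      (∀ ((_ , x) : Columns ms) → Admissible x ds n → StacksAfter x ds n ↔ Fin (C (modesAfter x) (deficitsAfter x ds) (n ∸ lastPart x))) →
      Stacks ms ds n ↔ Fin (unfoldCount C ms ds n)
    Stacks↔Fin-unfold C ms ds n after↔ =
      Stacks-step ms ds n
      ⨾ (Squash↔Fin (Exhausted? ms ds n)
         ⊎-↔ Σ↔Fin-∑ (proj₂ (Columns-finite ms)) (λ cx → columnTerm C cx ds n)
                     (λ (_ , x) → Squash×↔Fin (Admissible? x ds n) (after↔ (_ , x))))
      ⨾ ↔-sym +↔⊎

    stackCountWithin : ℕ → Vec Mode ℓ → Vec ℕ ℓ → ℕ → ℕ
    stackCountWithin zero    _ _ _ = 0
    stackCountWithin (suc f)       = unfoldCount (stackCountWithin f)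

    Stacks↔Fin-within : ∀ f ms ds n → n + pendings ms < f → Stacks ms ds n ↔ Fin (stackCountWithin f ms ds n)
    Stacks↔Fin-within (suc f) ms ds n lt =
      Stacks↔Fin-unfold (stackCountWithin f) ms ds n
        (λ (_ , x) (t≤n , _) → Stacks↔Fin-within f _ _ _ (column-decreases x t≤n lt))

    -- Every column lowers n + pendings ms (column-decreases), so this much fuel suffices.
    stackCount : Vec Mode ℓ → Vec ℕ ℓ → ℕ → ℕ
    stackCount ms ds n = stackCountWithin (suc (n + pendings ms)) ms ds n

    Stacks↔Fin : ∀ {ms ds n} → Stacks ms ds n ↔ Fin (stackCount ms ds n)
    Stacks↔Fin {ms} {ds} {n} = Stacks↔Fin-within _ ms ds n ℕ.≤-refl

    stackCount-unfold : ∀ ms ds n → stackCount ms ds n ≡ unfoldCount stackCount ms ds n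
    stackCount-unfold ms ds n = ↔Fin-unique Stacks↔Fin (Stacks↔Fin-unfold stackCount ms ds n (λ _ _ → Stacks↔Fin))

  -- Rationality

  -- Plain columns are the self-loops of the recursion: on an all-matched stack they change
  -- neither the links (modesAfter-allMatched) nor the deficits (Plain-deficits).
  Plain : ∀ {ℓ} {ms : Vec Mode ℓ} {c} → Column ms c → Set
  Plain (last _)                  = ⊤
  Plain (drop _)                  = ⊥
  Plain (absent _)                = ⊥
  Plain (skip _)                  = ⊥
  Plain (match {w = w} {a} _ _ x) = a ≡ w × Plain x

  Plain? : ∀ {ℓ} {ms : Vec Mode ℓ} {c} (x : Column ms c) → Dec (Plain x)
  Plain? (last _)                  = yes tt
  Plain? (drop _)                  = no λ ()
  Plain? (absent _)                = no λ ()
  Plain? (skip _)                  = no λ ()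
  Plain? (match {w = w} {a} _ _ x) = (a ≟ w) ×-dec Plain? x

  Plain-top : ∀ {ℓ} {ms : Vec Mode ℓ} {c} (x : Column ms c) → Plain x → c ≡ just (lastPart x)
  Plain-top (last _)    _           = refl
  Plain-top (match _ _ x) (refl , px) = Plain-top x px

  Plain-fits : ∀ {ℓ} {ms : Vec Mode ℓ} {c} (x : Column ms c) → Plain x → ∀ ds → DeficitsFit x ds
  Plain-fits (last _)              _           []       = tt
  Plain-fits (match {a = a} _ _ x) (refl , px) (d ∷ ds) =
    subst (_≤ a + d) (just-injective (Plain-top x px)) (ℕ.m≤m+n a d) , Plain-fits x px ds

  Plain-deficits : ∀ {ℓ} {ms : Vec Mode ℓ} {c} (x : Column ms c) → Plain x → ∀ ds → deficitsAfter x ds ≡ ds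
  Plain-deficits (last _)              _           []       = refl
  Plain-deficits (match {a = a} _ _ x) (refl , px) (d ∷ ds) =
    cong₂ _∷_ (trans (cong (a + d ∸_) (sym (just-injective (Plain-top x px)))) (ℕ.m+n∸m≡n a d))
              (Plain-deficits x px ds)

  top-≤-lastPart : ∀ {ℓ} {ms : Vec Mode ℓ} {c} (x : Column ms c) → pendings ms ≡ 0 → fromMaybe 0 c ≤ lastPart x
  top-≤-lastPart (last _)       _  = ℕ.≤-refl
  top-≤-lastPart (absent x)     _  = z≤n
  top-≤-lastPart (skip x)       _  = z≤n
  top-≤-lastPart (match _ le x) p0 = ℕ.≤-trans le (top-≤-lastPart x p0)

  lastPart-positive : ∀ {ℓ} {ms : Vec Mode ℓ} {c} (x : Column ms c) → pendings ms ≡ 0 → 1 ≤ lastPart x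
  lastPart-positive x p0 with column-cases x
  ... | inj₁ (_ , p) = ⊥-elim (ℕ.1+n≢0 (trans p p0))
  ... | inj₂ (1≤t , _) = 1≤t

  deficits-nonincreasing : ∀ {ℓ} {ms : Vec Mode ℓ} {c} (x : Column ms c) ds → pendings ms ≡ 0 →
                           DeficitsFit x ds → Vec.sum (deficitsAfter x ds) ≤ Vec.sum ds
  deficits-nonincreasing (last _) [] _ _ = ℕ.≤-refl
  deficits-nonincreasing (absent x) (d ∷ ds) p0 (_ , fit) =
    ℕ.+-mono-≤ (ℕ.m∸n≤m d (lastPart x)) (deficits-nonincreasing x ds p0 fit)
  deficits-nonincreasing (skip x) (d ∷ ds) p0 (_ , fit) =
    ℕ.+-mono-≤ (ℕ.m∸n≤m d (lastPart x)) (deficits-nonincreasing x ds p0 fit)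
  deficits-nonincreasing (match _ le x) (d ∷ ds) p0 (_ , fit) =
    ℕ.+-mono-≤ (+∸-≤ (ℕ.≤-trans le (top-≤-lastPart x p0))) (deficits-nonincreasing x ds p0 fit)

  deficits-decreasing : ∀ {ℓ} {ms : Vec Mode ℓ} {c} (x : Column ms c) ds → pendings ms ≡ 0 →
                        DeficitsFit x ds → ¬ Plain x → Vec.sum (deficitsAfter x ds) < Vec.sum ds
  deficits-decreasing (last _) [] _ _ ¬plain = ⊥-elim (¬plain tt)
  deficits-decreasing (absent x) (d ∷ ds) p0 (t≤d , fit) _ =
    ℕ.+-mono-<-≤ (ℕ.∸-monoʳ-< (lastPart-positive x p0) t≤d) (deficits-nonincreasing x ds p0 fit)
  deficits-decreasing (skip x) (d ∷ ds) p0 (t≤d , fit) _ =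
    ℕ.+-mono-<-≤ (ℕ.∸-monoʳ-< (lastPart-positive x p0) t≤d) (deficits-nonincreasing x ds p0 fit)
  deficits-decreasing (match {a = a} _ le x) (d ∷ ds) p0 (t≤a+d , fit) ¬plain with Plain? x
  ... | yes px rewrite Plain-deficits x px ds = ℕ.+-monoˡ-< (Vec.sum ds) (+∸-< a<t t≤a+d)
    where
    a<t : a < lastPart x
    a<t = subst (a <_) (just-injective (Plain-top x px)) (ℕ.≤∧≢⇒< le (λ a≡w → ¬plain (a≡w , px)))
  ... | no ¬px = ℕ.+-mono-≤-< (+∸-≤ (ℕ.≤-trans le (top-≤-lastPart x p0))) (deficits-decreasing x ds p0 fit ¬px)

  module _ {ℓ : ℕ} where

    series : Vec Mode ℓ → Vec ℕ ℓ → Series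
    series ms ds n = toℚ (stackCount ms ds n)

    emptySeries : Vec Mode ℓ → Vec ℕ ℓ → Series
    emptySeries ms ds n = if does (Exhausted? ms ds n) then 1ℚ else 0ℚ

    columnSeries : ∀ {ms} → Columns ms → Vec ℕ ℓ → Series
    columnSeries (_ , x) ds n =
      if does (DeficitsFit? x ds) then shift (lastPart x) (series (modesAfter x) (deficitsAfter x ds)) n else 0ℚ

    toℚ-columnTerm : ∀ {ms} (cx : Columns ms) ds n → toℚ (columnTerm stackCount cx ds n) ≡ columnSeries cx ds n
    toℚ-columnTerm (_ , x) ds n = begin
      toℚ (if does ((t ≤? n) ×-dec DeficitsFit? x ds) then stackCount ms′ ds′ (n ∸ t) else 0)
        ≡⟨ cong toℚ (if-×-dec (t ≤? n) (DeficitsFit? x ds) _) ⟩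
      toℚ (if does (DeficitsFit? x ds) then (if does (t ≤? n) then stackCount ms′ ds′ (n ∸ t) else 0) else 0)
        ≡⟨ if-float toℚ (does (DeficitsFit? x ds)) ⟩
      (if does (DeficitsFit? x ds) then toℚ (if does (t ≤? n) then stackCount ms′ ds′ (n ∸ t) else 0) else 0ℚ)
        ≡⟨ cong (λ q → if does (DeficitsFit? x ds) then q else 0ℚ) (toℚ-if-≤ (t ≤? n) (stackCount ms′ ds′)) ⟩
      columnSeries (_ , x) ds n
        ∎
      where
      open ≡-Reasoning
      t : ℕ
      t = lastPart x
      ms′ : Vec Mode ℓ
      ms′ = modesAfter x
      ds′ : Vec ℕ ℓ
      ds′ = deficitsAfter x ds

    series-unfold : ∀ ms ds n → series ms ds n ≡ emptySeries ms ds n ℚ.+ ℚΣ.sum (λ i → columnSeries (column ms i) ds n)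
    series-unfold ms ds n =
      trans (cong toℚ (stackCount-unfold ms ds n))
      (trans (toℚ-+ (if does (Exhausted? ms ds n) then 1 else 0) (∑[ i < _ ] term i))
             (cong₂ ℚ._+_ (if-float toℚ (does (Exhausted? ms ds n)))
                          (trans (toℚ-∑ _ term) (ℚΣ.sum-cong-≗ (λ i → toℚ-columnTerm (column ms i) ds n)))))
      where
      term : Fin (columnCount ms) → ℕ
      term i = columnTerm stackCount (column ms i) ds n

    emptySeries-EventuallyZero : ∀ ms ds → EventuallyZero (emptySeries ms ds)
    emptySeries-EventuallyZero ms ds = 1 , λ { (suc n) _ → refl }

    allMatched : Vec Mode ℓ
    allMatched = replicate ℓ matched

    modesAfter-allMatched : ∀ {c} (x : Column allMatched c) → modesAfter x ≡ allMatched
    modesAfter-allMatched x with column-cases x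
    ... | inj₁ (_ , p)     = ⊥-elim (ℕ.1+n≢0 (trans p (pendings-allMatched ℓ)))
    ... | inj₂ (_ , e , _) = e

    modesAfter-pendings : ∀ {ms : Vec Mode ℓ} {c} (x : Column ms c) → pendings ms ≢ 0 → pendings (modesAfter x) < pendings ms
    modesAfter-pendings x p≢0 with column-cases x
    ... | inj₁ (_ , p)      = ℕ.≤-reflexive p
    ... | inj₂ (_ , _ , p0) = ⊥-elim (p≢0 p0)

    plainLoop : Fin (columnCount allMatched) → Polynomial
    plainLoop i = if does (Plain? x) then monomial (lastPart x) (ℚ.- 1ℚ) else []
      where
      x : Column allMatched (proj₁ (column allMatched i))
      x = proj₂ (column allMatched i)

    loop : Polynomial
    loop = (1ℚ ∷ []) +ₚ ∑ₚ (columnCount allMatched) plainLoop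

    constantTerm-loop : constantTerm loop ≡ 1ℚ
    constantTerm-loop = begin
      constantTerm ((1ℚ ∷ []) +ₚ ∑ₚ _ plainLoop)        ≡⟨ constantTerm-+ₚ (1ℚ ∷ []) (∑ₚ _ plainLoop) ⟩
      1ℚ ℚ.+ constantTerm (∑ₚ _ plainLoop)              ≡⟨ cong (1ℚ ℚ.+_) (constantTerm-∑ₚ _ plainLoop zero-term) ⟩
      1ℚ ℚ.+ 0ℚ                                         ≡⟨ ℚ.+-identityʳ 1ℚ ⟩
      1ℚ                                                ∎
      where
      open ≡-Reasoning
      zero-term : ∀ i → constantTerm (plainLoop i) ≡ 0ℚ
      zero-term i = vanish (Plain? x) (lastPart-positive x (pendings-allMatched ℓ))
        where
        x : Column allMatched (proj₁ (column allMatched i))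
        x = proj₂ (column allMatched i)
        vanish : ∀ {t} (d : Dec (Plain x)) → 1 ≤ t → constantTerm (if does d then monomial t (ℚ.- 1ℚ) else []) ≡ 0ℚ
        vanish (yes _) (s≤s _) = refl
        vanish (no _)  _       = refl

    open Localisation loop

    plainShift : Series → Fin (columnCount allMatched) → Series
    plainShift a i n = if does (Plain? x) then shift (lastPart x) a n else 0ℚ
      where
      x : Column allMatched (proj₁ (column allMatched i))
      x = proj₂ (column allMatched i)

    nonPlainSeries : Columns allMatched → Vec ℕ ℓ → Series
    nonPlainSeries (c , x) ds n = if does (Plain? x) then 0ℚ else columnSeries (c , x) ds n

    mulCoeff-loop : ∀ a n → mulCoeff loop a n ≡ a n ℚ.+ (ℚ.- 1ℚ) ℚ.* ℚΣ.sum (λ i → plainShift a i n)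
    mulCoeff-loop a n = begin
      mulCoeff loop a n                                               ≡⟨ mulCoeff-+ₚ (1ℚ ∷ []) (∑ₚ _ plainLoop) a n ⟩
      mulCoeff (1ℚ ∷ []) a n ℚ.+ mulCoeff (∑ₚ _ plainLoop) a n        ≡⟨ cong₂ ℚ._+_ (mulCoeff-one n) (mulCoeff-∑ₚ _ plainLoop a n) ⟩
      a n ℚ.+ ℚΣ.sum (λ i → mulCoeff (plainLoop i) a n)               ≡⟨ cong (a n ℚ.+_) (ℚΣ.sum-cong-≗ term) ⟩
      a n ℚ.+ ℚΣ.sum (λ i → (ℚ.- 1ℚ) ℚ.* plainShift a i n)            ≡⟨ cong (a n ℚ.+_) (ℚΣ.*-distribˡ-sum (ℚ.- 1ℚ) (λ i → plainShift a i n)) ⟨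
      a n ℚ.+ (ℚ.- 1ℚ) ℚ.* ℚΣ.sum (λ i → plainShift a i n)            ∎
      where
      open ≡-Reasoning
      mulCoeff-one : ∀ n → mulCoeff (1ℚ ∷ []) a n ≡ a n
      mulCoeff-one zero    = ℚ.*-identityˡ (a 0)
      mulCoeff-one (suc n) = trans (ℚ.+-identityʳ _) (ℚ.*-identityˡ (a (suc n)))
      term : ∀ i → mulCoeff (plainLoop i) a n ≡ (ℚ.- 1ℚ) ℚ.* plainShift a i n
      term i = by-plainness (Plain? (proj₂ (column allMatched i)))
        where
        by-plainness : ∀ {x : Column allMatched _} (d : Dec (Plain x)) →
          mulCoeff (if does d then monomial (lastPart x) (ℚ.- 1ℚ) else []) a n ≡
          (ℚ.- 1ℚ) ℚ.* (if does d then shift (lastPart x) a n else 0ℚ)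
        by-plainness {x} (yes _) = mulCoeff-monomial (lastPart x) (ℚ.- 1ℚ) a n
        by-plainness     (no _)  = sym (ℚ.*-zeroʳ (ℚ.- 1ℚ))

    columnSeries-split : ∀ ds n (i : Fin (columnCount allMatched)) →
      columnSeries (column allMatched i) ds n ≡ plainShift (series allMatched ds) i n ℚ.+ nonPlainSeries (column allMatched i) ds n
    columnSeries-split ds n i = by-plainness (column allMatched i) (Plain? (proj₂ (column allMatched i)))
      where
      by-plainness : ∀ ((c , x) : Columns allMatched) (d : Dec (Plain x)) →
        columnSeries (c , x) ds n ≡
        (if does d then shift (lastPart x) (series allMatched ds) n else 0ℚ) ℚ.+ (if does d then 0ℚ else columnSeries (c , x) ds n)
      by-plainness (c , x) (no _)    = sym (ℚ.+-identityˡ _)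
      by-plainness (c , x) (yes px) = trans plain (sym (ℚ.+-identityʳ _))
        where
        plain : columnSeries (c , x) ds n ≡ shift (lastPart x) (series allMatched ds) n
        plain = trans (cong (λ b → if b then shift (lastPart x) (series (modesAfter x) (deficitsAfter x ds)) n else 0ℚ)
                            (dec-true (DeficitsFit? x ds) (Plain-fits x px ds)))
                      (cong₂ (λ ms′ ds′ → shift (lastPart x) (series ms′ ds′) n) (modesAfter-allMatched x) (Plain-deficits x px ds))

    loop-series : ∀ ds → mulCoeff loop (series allMatched ds) ≗
                  λ n → emptySeries allMatched ds n ℚ.+ ℚΣ.sum (λ i → nonPlainSeries (column allMatched i) ds n)
    loop-series ds n = begin
      mulCoeff loop a n                               ≡⟨ mulCoeff-loop a n ⟩
      a n ℚ.+ (ℚ.- 1ℚ) ℚ.* ΣS                        ≡⟨ cong (ℚ._+ (ℚ.- 1ℚ) ℚ.* ΣS) (series-unfold allMatched ds n) ⟩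
      (E ℚ.+ ℚΣ.sum C) ℚ.+ (ℚ.- 1ℚ) ℚ.* ΣS            ≡⟨ cong (λ z → (E ℚ.+ z) ℚ.+ (ℚ.- 1ℚ) ℚ.* ΣS) ΣC≡ ⟩
      (E ℚ.+ (ΣS ℚ.+ ΣN)) ℚ.+ (ℚ.- 1ℚ) ℚ.* ΣS         ≡⟨ solve 3 (λ e s t → (e :+ (s :+ t)) :+ (:- con 1ℚ) :* s := e :+ t) refl E ΣS ΣN ⟩
      E ℚ.+ ΣN                                        ∎
      where
      open ≡-Reasoning
      a : Series
      a = series allMatched ds
      E ΣS ΣN : ℚ
      E = emptySeries allMatched ds n
      ΣS = ℚΣ.sum (λ i → plainShift a i n)
      ΣN = ℚΣ.sum (λ i → nonPlainSeries (column allMatched i) ds n)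
      C : Fin (columnCount allMatched) → ℚ
      C i = columnSeries (column allMatched i) ds n
      ΣC≡ : ℚΣ.sum C ≡ ΣS ℚ.+ ΣN
      ΣC≡ = trans (ℚΣ.sum-cong-≗ (columnSeries-split ds n))
                  (ℚΣ.∑-distrib-+ (λ i → plainShift a i n) (λ i → nonPlainSeries (column allMatched i) ds n))

    InLocalisation-series-allMatched : ∀ B ds → Vec.sum ds < B → InLocalisation (series allMatched ds)
    InLocalisation-series-allMatched (suc B) ds lt =
      InLocalisation-step (loop-series ds)
        (InLocalisation-+ (EventuallyZero⇒InLocalisation (emptySeries-EventuallyZero allMatched ds))
                          (InLocalisation-∑ _ _ (λ i → nonPlain (column allMatched i))))
      where
      nonPlain : ∀ cx → InLocalisation (nonPlainSeries cx ds)
      nonPlain (c , x) = by-plainness (Plain? x)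
        where
        by-plainness : (d : Dec (Plain x)) → InLocalisation (λ n → if does d then 0ℚ else columnSeries (c , x) ds n)
        by-plainness (yes _)   = InLocalisation-0
        by-plainness (no ¬px) = InLocalisation-if (DeficitsFit? x ds) λ fit →
          InLocalisation-shift (lastPart x)
            (subst (λ ms → InLocalisation (series ms (deficitsAfter x ds))) (sym (modesAfter-allMatched x))
                   (InLocalisation-series-allMatched B (deficitsAfter x ds)
                      (ℕ.<-≤-trans (deficits-decreasing x ds (pendings-allMatched ℓ) fit ¬px) (s≤s⁻¹ lt))))

    InLocalisation-series : ∀ P ms ds → pendings ms ≤ P → InLocalisation (series ms ds)
    InLocalisation-series P ms ds le with pendings ms ≟ 0
    ... | yes p0 = subst (λ ms → InLocalisation (series ms ds)) (sym (pendings≡0⇒allMatched ms p0))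
                         (InLocalisation-series-allMatched _ ds ℕ.≤-refl)
    InLocalisation-series zero    ms ds le | no p≢0 = ⊥-elim (p≢0 (ℕ.n≤0⇒n≡0 le))
    InLocalisation-series (suc P) ms ds le | no p≢0 =
      InLocalisation-cong (λ n → sym (series-unfold ms ds n))
        (InLocalisation-+ (EventuallyZero⇒InLocalisation (emptySeries-EventuallyZero ms ds))
                          (InLocalisation-∑ _ _ (λ i → columnLocal (column ms i))))
      where
      columnLocal : ∀ cx → InLocalisation (columnSeries cx ds)
      columnLocal (c , x) = InLocalisation-if (DeficitsFit? x ds) λ _ →
        InLocalisation-shift (lastPart x)
          (InLocalisation-series P (modesAfter x) (deficitsAfter x ds) (s≤s⁻¹ (ℕ.<-≤-trans (modesAfter-pendings x p≢0) le)))

  cardSequenceCount : ℕ → ℕ → ℕ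
  cardSequenceCount ℓ b = ∑[ i < 2 ^ suc ℓ ] stackCount (Inverse.from (Modes↔Fin (suc ℓ)) i) (replicate (suc ℓ) 0) b

  CardSeq↔Fin : ∀ ℓ b → CardSeq b k (suc ℓ) ↔ Fin (cardSequenceCount ℓ b)
  CardSeq↔Fin ℓ b = CardSeq↔Rows b ℓ ⨾ Σ↔Fin-∑ (Modes↔Fin (suc ℓ)) (λ ms → stackCount ms _ b) (λ _ → Stacks↔Fin)

  cardSequenceCount-rational : ∀ ℓ → IsRationalGF (cardSequenceCount ℓ)
  cardSequenceCount-rational ℓ =
    InLocalisation⇒IsRationalGF (constantTerm-loop {suc ℓ}) (cardSequenceCount ℓ)
      (InLocalisation-cong (λ b → sym (toℚ-∑ _ (λ i → stackCount (modes i) zeros b)))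
        (InLocalisation-∑ _ _ (λ i → InLocalisation-series _ (modes i) zeros ℕ.≤-refl)))
    where
    open Localisation (loop {suc ℓ})
    modes : Fin (2 ^ suc ℓ) → Vec Mode (suc ℓ)
    modes = Inverse.from (Modes↔Fin (suc ℓ))
    zeros : Vec ℕ (suc ℓ)
    zeros = replicate (suc ℓ) 0

corollary5p4 : (k ℓ : ℕ) → 1 ≤ k → 1 ≤ ℓ →
    ∃ λ (J : ℕ → ℕ) → (∀ b → CardSeq b k ℓ ↔ Fin (J b)) × IsRationalGF J
corollary5p4 k (suc ℓ) _ _ = cardSequenceCount k ℓ , CardSeq↔Fin k ℓ , cardSequenceCount-rational k ℓ
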